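{- Let $N\geq 5$ and let $C_N^2$ be the graph with vertex set $\mathbb{Z}_N$ in which $u,v$ are adjacent iff $u-v\in\{\pm1,\pm2\}$ (mod $N$). For $l\in\{0,1,\dots,N-1\}$, let $h_N(0,l)$ be the expected hitting time from vertex $0$ to vertex $l$ of the simple random walk on $C_N^2$. Then \[ h_N(0,l)=\frac{2}{5}\left(l(N-l)+2N\frac{F_{l}F_{N-l}}{F_{N}}\right). \]
   Context: $F_i$ denotes the $i$-th Fibonacci number ($F_0=0$, $F_1=1$, $F_{i+1}=F_i+F_{i-1}$). The simple random walk moves from a vertex $u$ to each neighbour of $u$ with probability $1/\deg(u)$; the hitting time from $p$ to $q$ is the number of steps until the walk started at $p$ first reaches $q$ (so $h_N(0,0)=0$). -}

module Defs where

open import Data.Bool.Base using (Bool; true; false; _∨_; _∧_; not; if_then_else_)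
open import Data.Nat.Base as ℕ using (ℕ; zero; suc; _∸_; _≡ᵇ_)
open import Data.Fin.Base using (Fin; toℕ)
open import Data.Integer.Base using (+_)
open import Data.Rational.Base using (ℚ; 0ℚ; 1ℚ; _/_; _+_; _*_)

fib : ℕ → ℕ
fib zero = 0
fib (suc zero) = 1
fib (suc (suc n)) = fib (suc n) ℕ.+ fib n

-- a / b as a rational (b = 0 gives 0; never used with b = 0 in the theorem)
frac : ℕ → ℕ → ℚ
frac a zero = 0ℚ
frac a (suc b) = (+ a) / suc b

absdiff : ℕ → ℕ → ℕ
absdiff a b = (a ∸ b) ℕ.+ (b ∸ a)

-- Adjacency in C_N^2 on vertex set Z_N = Fin N:
-- u ~ v iff u - v ∈ {±1, ±2} (mod N), i.e. |u - v| ∈ {1, 2, N-1, N-2} for 0 ≤ u,v < N.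
adj : (N : ℕ) → Fin N → Fin N → Bool
adj N u v = (d ≡ᵇ 1) ∨ (d ≡ᵇ 2) ∨ (d ≡ᵇ (N ∸ 1)) ∨ (d ≡ᵇ (N ∸ 2))
  where d = absdiff (toℕ u) (toℕ v)

sumFin : ∀ {n} → (Fin n → ℚ) → ℚ
sumFin {zero} f = 0ℚ
sumFin {suc n} f = f Data.Fin.Base.zero + sumFin (λ i → f (Data.Fin.Base.suc i))

countFin : ∀ {n} → (Fin n → Bool) → ℕ
countFin {zero} f = 0
countFin {suc n} f = (if f Data.Fin.Base.zero then 1 else 0) ℕ.+ countFin (λ i → f (Data.Fin.Base.suc i))

deg : (N : ℕ) → Fin N → ℕ
deg N u = countFin (adj N u)

trans : (N : ℕ) → Fin N → Fin N → ℚ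
trans N u v = if adj N u v then frac 1 (deg N u) else 0ℚ

eqFin : ∀ {n} → Fin n → Fin n → Bool
eqFin i j = toℕ i ≡ᵇ toℕ j

-- killed walk: q N l t w = P(walk from 0 is at w at time t and has not visited l at
-- any time s < t).  Hence P(T_l = t) = q N l t l, where T_l is the hitting time of l.
q : (N : ℕ) → Fin N → ℕ → Fin N → ℚ
q N l zero w = if toℕ w ≡ᵇ 0 then 1ℚ else 0ℚ
q N l (suc t) w = sumFin (λ v → if eqFin v l then 0ℚ else q N l t v * trans N v w)

hitProb : (N : ℕ) → Fin N → ℕ → ℚ
hitProb N l t = q N l t l

massUpTo : (N : ℕ) → Fin N → ℕ → ℚ
massUpTo N l zero = hitProb N l zero
massUpTo N l (suc T) = massUpTo N l T + hitProb N l (suc T)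

expUpTo : (N : ℕ) → Fin N → ℕ → ℚ
expUpTo N l zero = 0ℚ
expUpTo N l (suc T) = expUpTo N l T + frac (suc T) 1 * hitProb N l (suc T)

formula : (N l : ℕ) → ℚ
formula N l = frac 2 5 * (frac (l ℕ.* (N ∸ l)) 1
                          + frac (2 ℕ.* N ℕ.* fib l ℕ.* fib (N ∸ l)) (fib N))

module Submission where

-- Let f = formula N.  Besides f 0 = f N = 0, four Fibonacci product identities give the mean-value
-- equation f(k-2) + f(k-1) + f(k+1) + f(k+2) = 4 (f k - 1) for 0 < k < N, indices read around the cycle.
-- So H(w) = f(w - l mod N) has H(l) = 0, 1 ≤ H ≤ B off l, and one step of the walk lowers it by 1 on
-- average away from l.  For the walk killed at l, with surviving mass S_t and potential R_t = E[H(X_t); t < T],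
-- this gives R_{t+1} = R_t - S_t, hence P(T ≤ t) = 1 - S_t and E[T; T ≤ t] + t S_t + R_t = R_0 = f(l).
-- Finally R_{t+1} ≤ (1 - 1/B) R_t, which an induction turns into R_t ≤ C/(t + 2B)²; so (t + 1) R_t → 0,
-- and both error terms, S_t and t S_t + R_t, are at most (t + 1) R_t.

open import Defs

module Fibonacci where
  open import Data.Nat.Base
  open import Data.Nat.Tactic.RingSolver using (solve-∀)
  import Data.Nat.Properties as ℕP
  open import Relation.Binary.PropositionalEquality

  fib-pos : ∀ m → 0 < fib (suc m)
  fib-pos zero    = s≤s z≤n
  fib-pos (suc m) = ℕP.≤-trans (fib-pos m) (ℕP.m≤m+n (fib (suc m)) (fib m))

  fib-mono-suc : ∀ m → fib m ≤ fib (suc m)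
  fib-mono-suc zero    = z≤n
  fib-mono-suc (suc m) = ℕP.m≤m+n (fib (suc m)) (fib m)

  fib-*-≤-fib-+ : ∀ a b → fib a * fib b ≤ fib (a + b)
  fib-*-≤-fib-+ zero          b = z≤n
  fib-*-≤-fib-+ (suc zero)    b = ℕP.≤-trans (ℕP.≤-reflexive (ℕP.+-identityʳ (fib b))) (fib-mono-suc b)
  fib-*-≤-fib-+ (suc (suc a)) b = ℕP.≤-trans (ℕP.≤-reflexive (ℕP.*-distribʳ-+ (fib b) (fib (suc a)) (fib a)))
    (ℕP.+-mono-≤ (fib-*-≤-fib-+ (suc a) b) (fib-*-≤-fib-+ a b))

  -- 5 F_N / 2 times the claimed value of h_N(0, k), with k′ = N - k.
  Q : (N F k k′ : ℕ) → ℕ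
  Q N F k k′ = k * k′ * F + 2 * N * fib k * fib k′

  -- In the `expanded` forms the Fibonacci values are spelled out by the recurrence, exactly as fib unfolds
  -- definitionally, so each identity becomes a polynomial one that solve-∀ can check.
  Q-interior : ∀ N F a b →
    Q N F a (4 + b) + Q N F (1 + a) (3 + b) + Q N F (3 + a) (1 + b) + Q N F (4 + a) b + 10 * F
      ≡ 4 * Q N F (2 + a) (2 + b)
  Q-interior N F a b = expanded N F a b (fib a) (fib (suc a)) (fib b) (fib (suc b))
    where
    expanded : ∀ N F a b A A₁ B B₁ →
      let A₂ = A₁ + A; A₃ = A₂ + A₁; A₄ = A₃ + A₂
          B₂ = B₁ + B; B₃ = B₂ + B₁; B₄ = B₃ + B₂ in
      a * (4 + b) * F + 2 * N * A * B₄ + ((1 + a) * (3 + b) * F + 2 * N * A₁ * B₃)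
      + ((3 + a) * (1 + b) * F + 2 * N * A₃ * B₁) + ((4 + a) * b * F + 2 * N * A₄ * B) + 10 * F
      ≡ 4 * ((2 + a) * (2 + b) * F + 2 * N * A₂ * B₂)
    expanded = solve-∀

  Q-at-1 : ∀ n → let N = 5 + n; F = fib N in
    Q N F (4 + n) 1 + Q N F 0 N + Q N F 2 (3 + n) + Q N F 3 (2 + n) + 10 * F ≡ 4 * Q N F 1 (4 + n)
  Q-at-1 n = expanded n (fib n) (fib (suc n))
    where
    expanded : ∀ n P P₁ →
      let P₂ = P₁ + P; P₃ = P₂ + P₁; P₄ = P₃ + P₂; P₅ = P₄ + P₃; N = 5 + n in
      (4 + n) * 1 * P₅ + 2 * N * P₄ * 1 + (0 * N * P₅ + 2 * N * 0 * P₅)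
      + (2 * (3 + n) * P₅ + 2 * N * 1 * P₃) + (3 * (2 + n) * P₅ + 2 * N * 2 * P₂) + 10 * P₅
      ≡ 4 * (1 * (4 + n) * P₅ + 2 * N * 1 * P₄)
    expanded = solve-∀

  Q-at-N-1 : ∀ n → let N = 5 + n; F = fib N in
    Q N F (2 + n) 3 + Q N F (3 + n) 2 + Q N F 0 N + Q N F 1 (4 + n) + 10 * F ≡ 4 * Q N F (4 + n) 1
  Q-at-N-1 n = expanded n (fib n) (fib (suc n))
    where
    expanded : ∀ n P P₁ →
      let P₂ = P₁ + P; P₃ = P₂ + P₁; P₄ = P₃ + P₂; P₅ = P₄ + P₃; N = 5 + n in
      (2 + n) * 3 * P₅ + 2 * N * P₂ * 2 + ((3 + n) * 2 * P₅ + 2 * N * P₃ * 1) + (0 * N * P₅ + 2 * N * 0 * P₅)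
      + (1 * (4 + n) * P₅ + 2 * N * 1 * P₄) + 10 * P₅
      ≡ 4 * ((4 + n) * 1 * P₅ + 2 * N * P₄ * 1)
    expanded = solve-∀

  Q-zeroˡ : ∀ N F k → Q N F 0 k ≡ 0
  Q-zeroˡ N F k = vanish N (fib k)
    where
    vanish : ∀ N B → 2 * N * 0 * B ≡ 0
    vanish = solve-∀

  Q-zeroʳ : ∀ N F k → Q N F k 0 ≡ 0
  Q-zeroʳ N F k = vanish N F k (fib k)
    where
    vanish : ∀ N F k A → k * 0 * F + 2 * N * A * 0 ≡ 0
    vanish = solve-∀

  Q-comm : ∀ N F k k′ → Q N F k k′ ≡ Q N F k′ k
  Q-comm N F k k′ = swap N F k k′ (fib k) (fib k′)
    where
    swap : ∀ N F k k′ A B → k * k′ * F + 2 * N * A * B ≡ k′ * k * F + 2 * N * B * A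
    swap = solve-∀

  Q-≤ : ∀ N k k′ → k + k′ ≡ N → Q N (fib N) k k′ ≤ (N * N + 2 * N) * fib N
  Q-≤ N k k′ refl = begin
    k * k′ * F + 2 * N * fib k * fib k′     ≡⟨ cong (k * k′ * F +_) (ℕP.*-assoc (2 * N) (fib k) (fib k′)) ⟩
    k * k′ * F + 2 * N * (fib k * fib k′)   ≤⟨ ℕP.+-mono-≤ (ℕP.*-monoˡ-≤ F (ℕP.*-mono-≤ (ℕP.m≤m+n k k′) (ℕP.m≤n+m k′ k)))
                                                          (ℕP.*-monoʳ-≤ (2 * N) (fib-*-≤-fib-+ k k′)) ⟩
    N * N * F + 2 * N * F                   ≡⟨ ℕP.*-distribʳ-+ F (N * N) (2 * N) ⟨
    (N * N + 2 * N) * F                     ∎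
    where
    open ℕP.≤-Reasoning
    F : ℕ
    F = fib (k + k′)

  Q-≥ : ∀ N F a b → 2 + (a + b) ≡ N → (N ∸ 1) * F ≤ Q N F (suc a) (suc b)
  Q-≥ N F a b refl = ℕP.≤-trans (ℕP.*-monoˡ-≤ F (ℕP.≤-trans (ℕP.m≤m+n (suc (a + b)) (a * b)) (ℕP.≤-reflexive (expand a b))))
                                (ℕP.m≤m+n _ _)
    where
    expand : ∀ a b → suc (a + b) + a * b ≡ suc a * suc b
    expand = solve-∀

open Fibonacci

module HittingTime where
  open import Data.Bool.Base using (Bool; true; false; if_then_else_; _∨_; T)
  open import Data.Unit.Base using (tt)
  open import Data.Empty using (⊥-elim)
  open import Data.Fin.Base as Fin using (Fin; toℕ)
  open import Data.Fin.Properties using (toℕ<n)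
  import Data.Integer.Base as ℤ
  import Data.Integer.Properties as ℤP
  open import Data.Nat.Base as ℕ using (ℕ; zero; suc; z≤n; s≤s; _≡ᵇ_; _<ᵇ_; _%_)
  open import Data.Nat.DivMod using (%-congˡ; %-distribˡ-+; [m+n]%n≡m%n; m%n%n≡m%n; m%n<n; m%n≤n; m<n⇒m%n≡m; n%n≡0)
  open import Relation.Binary.Definitions using (Tri; tri<; tri≈; tri>)
  import Data.Nat.Properties as ℕP
  open import Data.Product using (Σ; Σ-syntax; _,_; _×_; proj₂; map₂)
  open import Data.Sum using (inj₁; inj₂)
  open import Data.Rational.Base
  open import Data.Rational.Properties
  import Data.Rational.Unnormalised.Base as ℚᵘ
  import Data.Rational.Unnormalised.Properties as ℚᵘP
  open import Data.Rational.Solver using (module +-*-Solver)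
  open import Data.Nat.Tactic.RingSolver using (solve-∀)
  open import Function.Base using (_∘_)
  open import Relation.Nullary using (¬_; yes; no)
  open import Relation.Nullary.Decidable using (dec-true; dec-false)
  open import Relation.Binary.PropositionalEquality hiding (trans)
  open import Relation.Binary.PropositionalEquality using (_≢_)
  import Relation.Binary.PropositionalEquality as ≡

  module NatCast where
    open import Data.Integer.Base using (+_; -[1+_])

    ι : ℕ → ℚ
    ι n = + n / 1

    private
      toℚᵘ-ι : ∀ n → toℚᵘ (ι n) ℚᵘ.≃ ℚᵘ.mkℚᵘ (+ n) 0
      toℚᵘ-ι n = toℚᵘ-fromℚᵘ (ℚᵘ.mkℚᵘ (+ n) 0)

    ι-homo-+ : ∀ m n → ι (m ℕ.+ n) ≡ ι m + ι n
    ι-homo-+ m n = toℚᵘ-injective (begin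
      toℚᵘ (ι (m ℕ.+ n))                            ≈⟨ toℚᵘ-ι (m ℕ.+ n) ⟩
      ℚᵘ.mkℚᵘ (+ (m ℕ.+ n)) 0                       ≈⟨ ℚᵘ.*≡* (cong₂ ℤ._*_ eq refl) ⟩
      ℚᵘ.mkℚᵘ (+ m) 0 ℚᵘ.+ ℚᵘ.mkℚᵘ (+ n) 0          ≈⟨ ℚᵘP.+-cong (toℚᵘ-ι m) (toℚᵘ-ι n) ⟨
      toℚᵘ (ι m) ℚᵘ.+ toℚᵘ (ι n)                   ≈⟨ toℚᵘ-homo-+ (ι m) (ι n) ⟨
      toℚᵘ (ι m + ι n)                             ∎)
      where
      open ℚᵘP.≃-Reasoning
      eq : + (m ℕ.+ n) ≡ + m ℤ.* + 1 ℤ.+ + n ℤ.* + 1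
      eq = ≡.trans (ℤP.pos-+ m n) (sym (cong₂ ℤ._+_ (ℤP.*-identityʳ (+ m)) (ℤP.*-identityʳ (+ n))))

    ι-homo-* : ∀ m n → ι (m ℕ.* n) ≡ ι m * ι n
    ι-homo-* m n = toℚᵘ-injective (begin
      toℚᵘ (ι (m ℕ.* n))                            ≈⟨ toℚᵘ-ι (m ℕ.* n) ⟩
      ℚᵘ.mkℚᵘ (+ (m ℕ.* n)) 0                       ≈⟨ ℚᵘ.*≡* (cong₂ ℤ._*_ (ℤP.pos-* m n) refl) ⟩
      ℚᵘ.mkℚᵘ (+ m) 0 ℚᵘ.* ℚᵘ.mkℚᵘ (+ n) 0          ≈⟨ ℚᵘP.*-cong (toℚᵘ-ι m) (toℚᵘ-ι n) ⟨
      toℚᵘ (ι m) ℚᵘ.* toℚᵘ (ι n)                   ≈⟨ toℚᵘ-homo-* (ι m) (ι n) ⟨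
      toℚᵘ (ι m * ι n)                             ∎)
      where open ℚᵘP.≃-Reasoning

    /-*-cancel : ∀ a b → (+ a / suc b) * ι (suc b) ≡ ι a
    /-*-cancel a b = toℚᵘ-injective (begin
      toℚᵘ ((+ a / suc b) * ι (suc b))                       ≈⟨ toℚᵘ-homo-* (+ a / suc b) (ι (suc b)) ⟩
      toℚᵘ (+ a / suc b) ℚᵘ.* toℚᵘ (ι (suc b))               ≈⟨ ℚᵘP.*-cong (toℚᵘ-fromℚᵘ (ℚᵘ.mkℚᵘ (+ a) b)) (toℚᵘ-ι (suc b)) ⟩
      ℚᵘ.mkℚᵘ (+ a) b ℚᵘ.* ℚᵘ.mkℚᵘ (+ suc b) 0                ≈⟨ ℚᵘ.*≡* (ℤP.*-assoc (+ a) (+ suc b) (+ 1)) ⟩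
      ℚᵘ.mkℚᵘ (+ a) 0                                        ≈⟨ toℚᵘ-ι a ⟨
      toℚᵘ (ι a)                                             ∎)
      where open ℚᵘP.≃-Reasoning

    frac≡ι*frac : ∀ a b → + a / suc b ≡ ι a * (+ 1 / suc b)
    frac≡ι*frac a b = toℚᵘ-injective (begin
      toℚᵘ (+ a / suc b)                             ≈⟨ toℚᵘ-fromℚᵘ (ℚᵘ.mkℚᵘ (+ a) b) ⟩
      ℚᵘ.mkℚᵘ (+ a) b                                ≈⟨ ℚᵘ.*≡* (cong₂ ℤ._*_ (sym (ℤP.*-identityʳ (+ a))) (cong (λ k → + suc k) (ℕP.+-identityʳ b))) ⟩
      ℚᵘ.mkℚᵘ (+ a) 0 ℚᵘ.* ℚᵘ.mkℚᵘ (+ 1) b           ≈⟨ ℚᵘP.*-cong (toℚᵘ-ι a) (toℚᵘ-fromℚᵘ (ℚᵘ.mkℚᵘ (+ 1) b)) ⟨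
      toℚᵘ (ι a) ℚᵘ.* toℚᵘ (+ 1 / suc b)              ≈⟨ toℚᵘ-homo-* (ι a) (+ 1 / suc b) ⟨
      toℚᵘ (ι a * (+ 1 / suc b))                      ∎)
      where open ℚᵘP.≃-Reasoning

    0≤ι : ∀ n → 0ℚ ≤ ι n
    0≤ι n = nonNegative⁻¹ (ι n) {{normalize-nonNeg n 1}}

    0<ι-suc : ∀ n → 0ℚ < ι (suc n)
    0<ι-suc n = positive⁻¹ (ι (suc n)) {{normalize-pos (suc n) 1}}

    ι-mono-≤ : ∀ {m n} → m ℕ.≤ n → ι m ≤ ι n
    ι-mono-≤ {m} m≤n with k , refl ← ℕP.m≤n⇒∃[o]m+o≡n m≤n = begin
      ι m          ≡⟨ +-identityʳ (ι m) ⟨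
      ι m + 0ℚ     ≤⟨ +-monoʳ-≤ (ι m) (0≤ι k) ⟩
      ι m + ι k    ≡⟨ ι-homo-+ m k ⟨
      ι (m ℕ.+ k)  ∎
      where open ≤-Reasoning

    ι-mono-< : ∀ {m n} → m ℕ.< n → ι m < ι n
    ι-mono-< {m} m<n with k , refl ← ℕP.m≤n⇒∃[o]m+o≡n m<n = begin-strict
      ι m               ≡⟨ +-identityʳ (ι m) ⟨
      ι m + 0ℚ          <⟨ +-monoʳ-< (ι m) (0<ι-suc k) ⟩
      ι m + ι (suc k)   ≡⟨ ι-homo-+ m (suc k) ⟨
      ι (m ℕ.+ suc k)   ≡⟨ cong ι (ℕP.+-suc m k) ⟩
      ι (suc m ℕ.+ k)   ∎
      where open ≤-Reasoning

    ι-injective : ∀ {m n} → ι m ≡ ι n → m ≡ n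
    ι-injective {m} {n} eq with ℕP.<-cmp m n
    ... | tri< m<n _ _ = ⊥-elim (<-irrefl eq (ι-mono-< m<n))
    ... | tri≈ _ m≡n _ = m≡n
    ... | tri> _ _ n<m = ⊥-elim (<-irrefl (sym eq) (ι-mono-< n<m))

    archimedean : ∀ ε → 0ℚ < ε → Σ[ d ∈ ℕ ] 1ℚ ≤ ε * ι (suc d)
    archimedean ε@(mkℚ (+ suc p) d _) _ = d , (begin
      1ℚ                          ≤⟨ ι-mono-≤ {1} {suc p} (s≤s z≤n) ⟩
      ι (suc p)                   ≡⟨ /-*-cancel (suc p) d ⟨
      (+ suc p / suc d) * ι (suc d) ≡⟨ cong (_* ι (suc d)) (↥p/↧p≡p ε) ⟩
      ε * ι (suc d)               ∎)
      where open ≤-Reasoning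
    archimedean (mkℚ (+ zero) _ _) (*<* (ℤ.+<+ ()))
    archimedean (mkℚ -[1+ _ ] _ _) (*<* ())

  open NatCast

  -- Finite sums over Fin

  ind : Bool → ℚ → ℚ
  ind b x = if b then x else 0ℚ

  sumFin-cong : ∀ {n} {f g : Fin n → ℚ} → (∀ i → f i ≡ g i) → sumFin f ≡ sumFin g
  sumFin-cong {zero}  eq = refl
  sumFin-cong {suc n} eq = cong₂ _+_ (eq Fin.zero) (sumFin-cong (eq ∘ Fin.suc))

  sumFin-zero : ∀ n → sumFin {n} (λ _ → 0ℚ) ≡ 0ℚ
  sumFin-zero zero    = refl
  sumFin-zero (suc n) = ≡.trans (+-identityˡ _) (sumFin-zero n)

  sumFin-+ : ∀ {n} (f g : Fin n → ℚ) → sumFin (λ i → f i + g i) ≡ sumFin f + sumFin g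
  sumFin-+ {zero}  f g = sym (+-identityˡ 0ℚ)
  sumFin-+ {suc n} f g = begin
    (f₀ + g₀) + sumFin (λ i → f (Fin.suc i) + g (Fin.suc i)) ≡⟨ cong ((f₀ + g₀) +_) (sumFin-+ (f ∘ Fin.suc) (g ∘ Fin.suc)) ⟩
    (f₀ + g₀) + (F + G)                                      ≡⟨ solve 4 (λ a b c d → (a :+ b) :+ (c :+ d) := (a :+ c) :+ (b :+ d)) refl f₀ g₀ F G ⟩
    (f₀ + F) + (g₀ + G)                                      ∎
    where
    open ≡-Reasoning
    open +-*-Solver
    f₀ g₀ F G : ℚ
    f₀ = f Fin.zero
    g₀ = g Fin.zero
    F = sumFin (f ∘ Fin.suc)
    G = sumFin (g ∘ Fin.suc)

  sumFin-*ˡ : ∀ {n} c (f : Fin n → ℚ) → sumFin (λ i → c * f i) ≡ c * sumFin f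
  sumFin-*ˡ {zero}  c f = sym (*-zeroʳ c)
  sumFin-*ˡ {suc n} c f = ≡.trans (cong (c * f Fin.zero +_) (sumFin-*ˡ c (f ∘ Fin.suc)))
                                  (sym (*-distribˡ-+ c (f Fin.zero) (sumFin (f ∘ Fin.suc))))

  sumFin-*ʳ : ∀ {n} c (f : Fin n → ℚ) → sumFin (λ i → f i * c) ≡ sumFin f * c
  sumFin-*ʳ c f = ≡.trans (sumFin-cong (λ i → *-comm (f i) c)) (≡.trans (sumFin-*ˡ c f) (*-comm c _))

  sumFin-comm : ∀ {m n} (f : Fin m → Fin n → ℚ) →
    sumFin (λ i → sumFin (λ j → f i j)) ≡ sumFin (λ j → sumFin (λ i → f i j))
  sumFin-comm {zero}  {n} f = sym (sumFin-zero n)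
  sumFin-comm {suc m} f = ≡.trans (cong (sumFin (f Fin.zero) +_) (sumFin-comm (f ∘ Fin.suc)))
                                  (sym (sumFin-+ (f Fin.zero) (λ j → sumFin (λ i → f (Fin.suc i) j))))

  sumFin-mono-≤ : ∀ {n} {f g : Fin n → ℚ} → (∀ i → f i ≤ g i) → sumFin f ≤ sumFin g
  sumFin-mono-≤ {zero}  f≤g = ≤-refl
  sumFin-mono-≤ {suc n} f≤g = +-mono-≤ (f≤g Fin.zero) (sumFin-mono-≤ (f≤g ∘ Fin.suc))

  sumFin-nonNeg : ∀ {n} {f : Fin n → ℚ} → (∀ i → 0ℚ ≤ f i) → 0ℚ ≤ sumFin f
  sumFin-nonNeg {n} 0≤f = ≤-trans (≤-reflexive (sym (sumFin-zero n))) (sumFin-mono-≤ 0≤f)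

  sumFin-point : ∀ {n} (l : Fin n) (f : Fin n → ℚ) → sumFin (λ w → if eqFin w l then f w else 0ℚ) ≡ f l
  sumFin-point {suc n} Fin.zero    f = ≡.trans (cong (f Fin.zero +_) (sumFin-zero n)) (+-identityʳ _)
  sumFin-point {suc n} (Fin.suc l) f = ≡.trans (+-identityˡ _) (sumFin-point l (f ∘ Fin.suc))

  sumFin-split : ∀ {n} (l : Fin n) (f : Fin n → ℚ) →
    sumFin f ≡ sumFin (λ w → if eqFin w l then 0ℚ else f w) + f l
  sumFin-split l f = begin
    sumFin f                                              ≡⟨ sumFin-cong split ⟩
    sumFin (λ w → off w + on w)                           ≡⟨ sumFin-+ off on ⟩
    sumFin off + sumFin on                                ≡⟨ cong (sumFin off +_) (sumFin-point l f) ⟩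
    sumFin off + f l                                      ∎
    where
    open ≡-Reasoning
    off on : _ → ℚ
    off w = if eqFin w l then 0ℚ else f w
    on  w = if eqFin w l then f w else 0ℚ
    split : ∀ w → f w ≡ off w + on w
    split w with eqFin w l
    ... | true  = sym (+-identityˡ _)
    ... | false = sym (+-identityʳ _)

  ι-countFin : ∀ {m} (p : Fin m → Bool) → ι (countFin p) ≡ sumFin (λ i → ind (p i) 1ℚ)
  ι-countFin {zero}  p = refl
  ι-countFin {suc m} p = ≡.trans (ι-homo-+ (if p Fin.zero then 1 else 0) (countFin (p ∘ Fin.suc)))
                                 (cong₂ _+_ (ι-indicator (p Fin.zero)) (ι-countFin (p ∘ Fin.suc)))
    where
    ι-indicator : ∀ b → ι (if b then 1 else 0) ≡ ind b 1ℚ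
    ι-indicator true  = refl
    ι-indicator false = refl

  module QuadraticDecay (b : ℕ) {R S : ℕ → ℚ}
    (R-suc : ∀ t → R (suc t) ≡ R t - S t)
    (R≤BS  : ∀ t → R t ≤ ι (suc b) * S t)
    (0≤R   : ∀ t → 0ℚ ≤ R t)
    (R₀≤B  : R 0 ≤ ι (suc b)) where

    private
      B D C : ℕ
      B = suc b
      D = 2 ℕ.* B
      C = B ℕ.* (D ℕ.* D)

      ι-nonNeg : ∀ n → NonNegative (ι n)
      ι-nonNeg n = nonNegative (0≤ι n)

    contraction : ∀ t → ι B * R (suc t) ≤ ι b * R t
    contraction t = begin
      ι B * R (suc t)              ≡⟨ cong₂ _*_ (ι-homo-+ 1 b) (R-suc t) ⟩
      (1ℚ + ι b) * (R t - S t)     ≡⟨ solve 3 (λ x r s → (con 1ℚ :+ x) :* (r :- s) := x :* r :+ (r :- (con 1ℚ :+ x) :* s)) refl (ι b) (R t) (S t) ⟩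
      ι b * R t + (R t - (1ℚ + ι b) * S t)
                                   ≤⟨ +-monoʳ-≤ (ι b * R t) (+-monoˡ-≤ (- ((1ℚ + ι b) * S t)) (≤-trans (R≤BS t) (≤-reflexive (cong (_* S t) (ι-homo-+ 1 b))))) ⟩
      ι b * R t + ((1ℚ + ι b) * S t - (1ℚ + ι b) * S t)
                                   ≡⟨ cong (ι b * R t +_) (+-inverseʳ ((1ℚ + ι b) * S t)) ⟩
      ι b * R t + 0ℚ               ≡⟨ +-identityʳ (ι b * R t) ⟩
      ι b * R t                    ∎
      where
      open ≤-Reasoning
      open +-*-Solver

    -- (B - 1)(u + 1)² ≤ B u² as soon as u ≥ 2B, which is what lets the bound survive one contraction step.
    square-step : ∀ t → b ℕ.* (suc (t ℕ.+ D) ℕ.* suc (t ℕ.+ D)) ℕ.≤ B ℕ.* ((t ℕ.+ D) ℕ.* (t ℕ.+ D))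
    square-step t = ℕP.≤-trans (ℕP.m≤m+n _ _) (ℕP.≤-reflexive (sym (expand b t)))
      where
      expand : ∀ b t → suc b ℕ.* ((t ℕ.+ 2 ℕ.* suc b) ℕ.* (t ℕ.+ 2 ℕ.* suc b))
        ≡ b ℕ.* (suc (t ℕ.+ 2 ℕ.* suc b) ℕ.* suc (t ℕ.+ 2 ℕ.* suc b)) ℕ.+ (t ℕ.* t ℕ.+ 4 ℕ.* t ℕ.+ 2 ℕ.* b ℕ.* t ℕ.+ 3 ℕ.* b ℕ.+ 4)
      expand = solve-∀

    R-decay : ∀ t → R t * ι ((t ℕ.+ D) ℕ.* (t ℕ.+ D)) ≤ ι C
    R-decay zero = begin
      R 0 * ι (D ℕ.* D)   ≤⟨ *-monoʳ-≤-nonNeg (ι (D ℕ.* D)) {{ι-nonNeg (D ℕ.* D)}} R₀≤B ⟩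
      ι B * ι (D ℕ.* D)   ≡⟨ ι-homo-* B (D ℕ.* D) ⟨
      ι C                 ∎
      where open ≤-Reasoning
    R-decay (suc t) = *-cancelˡ-≤-pos (ι B) {{normalize-pos B 1}} (begin
      ι B * (R (suc t) * ι U₁)           ≡⟨ *-assoc (ι B) (R (suc t)) (ι U₁) ⟨
      ι B * R (suc t) * ι U₁             ≤⟨ *-monoʳ-≤-nonNeg (ι U₁) {{ι-nonNeg U₁}} (contraction t) ⟩
      ι b * R t * ι U₁                   ≡⟨ solve 3 (λ x r y → x :* r :* y := r :* (x :* y)) refl (ι b) (R t) (ι U₁) ⟩
      R t * (ι b * ι U₁)                 ≡⟨ cong (R t *_) (ι-homo-* b U₁) ⟨
      R t * ι (b ℕ.* U₁)                 ≤⟨ *-monoˡ-≤-nonNeg (R t) {{nonNegative (0≤R t)}} (ι-mono-≤ (square-step t)) ⟩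
      R t * ι (B ℕ.* U)                  ≡⟨ cong (R t *_) (ι-homo-* B U) ⟩
      R t * (ι B * ι U)                  ≡⟨ solve 3 (λ r x y → r :* (x :* y) := x :* (r :* y)) refl (R t) (ι B) (ι U) ⟩
      ι B * (R t * ι U)                  ≤⟨ *-monoˡ-≤-nonNeg (ι B) {{ι-nonNeg B}} (R-decay t) ⟩
      ι B * ι C                          ∎)
      where
      open ≤-Reasoning
      open +-*-Solver
      U U₁ : ℕ
      U  = (t ℕ.+ D) ℕ.* (t ℕ.+ D)
      U₁ = suc (t ℕ.+ D) ℕ.* suc (t ℕ.+ D)

    [1+T]R→0 : ∀ ε → 0ℚ < ε → Σ[ T₀ ∈ ℕ ] (∀ T → T₀ ℕ.≤ T → ι (suc T) * R T < ε)
    [1+T]R→0 ε 0<ε with d , 1≤εd ← archimedean ε 0<ε =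
      suc d ℕ.* C , λ T T₀≤T → *-cancelˡ-<-nonNeg (ι (suc T)) {{ι-nonNeg (suc T)}} (begin-strict
        ι (suc T) * (ι (suc T) * R T)    ≡⟨ solve 2 (λ x r → x :* (x :* r) := r :* (x :* x)) refl (ι (suc T)) (R T) ⟩
        R T * (ι (suc T) * ι (suc T))    ≡⟨ cong (R T *_) (ι-homo-* (suc T) (suc T)) ⟨
        R T * ι (suc T ℕ.* suc T)        ≤⟨ *-monoˡ-≤-nonNeg (R T) {{nonNegative (0≤R T)}} (ι-mono-≤ (ℕP.*-mono-≤ (1+T≤T+D T) (1+T≤T+D T))) ⟩
        R T * ι ((T ℕ.+ D) ℕ.* (T ℕ.+ D)) ≤⟨ R-decay T ⟩
        ι C                              ≡⟨ *-identityˡ (ι C) ⟨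
        1ℚ * ι C                         ≤⟨ *-monoʳ-≤-nonNeg (ι C) {{ι-nonNeg C}} 1≤εd ⟩
        ε * ι (suc d) * ι C              ≡⟨ *-assoc ε (ι (suc d)) (ι C) ⟩
        ε * (ι (suc d) * ι C)            ≡⟨ cong (ε *_) (ι-homo-* (suc d) C) ⟨
        ε * ι (suc d ℕ.* C)              <⟨ *-monoʳ-<-pos ε {{positive 0<ε}} (ι-mono-< (s≤s T₀≤T)) ⟩
        ε * ι (suc T)                    ≡⟨ *-comm ε (ι (suc T)) ⟩
        ι (suc T) * ε                    ∎)
      where
      open ≤-Reasoning
      open +-*-Solver
      1+T≤T+D : ∀ T → suc T ℕ.≤ T ℕ.+ D
      1+T≤T+D T = ℕP.≤-trans (ℕP.≤-reflexive (ℕP.+-comm 1 T)) (ℕP.+-monoʳ-≤ T (s≤s z≤n))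

  module KilledChain {m : ℕ} (P : Fin m → Fin m → ℚ) (l : Fin m)
    (P-nonNeg     : ∀ v w → 0ℚ ≤ P v w)
    (P-stochastic : ∀ v → sumFin (P v) ≡ 1ℚ)
    (q : ℕ → Fin m → ℚ)
    (q-suc     : ∀ t w → q (suc t) w ≡ sumFin (λ v → if eqFin v l then 0ℚ else q t v * P v w))
    (q₀-nonNeg : ∀ w → 0ℚ ≤ q 0 w)
    (q₀-total  : sumFin (q 0) ≡ 1ℚ) where

    alive : ℕ → Fin m → ℚ
    alive t v = if eqFin v l then 0ℚ else q t v

    survival : ℕ → ℚ
    survival t = sumFin (alive t)

    q-nonNeg : ∀ t w → 0ℚ ≤ q t w
    q-nonNeg zero    w = q₀-nonNeg w
    q-nonNeg (suc t) w = ≤-trans (sumFin-nonNeg term-nonNeg) (≤-reflexive (sym (q-suc t w)))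
      where
      term-nonNeg : ∀ v → 0ℚ ≤ (if eqFin v l then 0ℚ else q t v * P v w)
      term-nonNeg v with eqFin v l
      ... | true  = ≤-refl
      ... | false = nonNegative⁻¹ _ {{nonNeg*nonNeg⇒nonNeg (q t v) {{nonNegative (q-nonNeg t v)}} (P v w) {{nonNegative (P-nonNeg v w)}}}}

    alive-nonNeg : ∀ t v → 0ℚ ≤ alive t v
    alive-nonNeg t v with eqFin v l
    ... | true  = ≤-refl
    ... | false = q-nonNeg t v

    survival-nonNeg : ∀ t → 0ℚ ≤ survival t
    survival-nonNeg t = sumFin-nonNeg (alive-nonNeg t)

    forward-equation : ∀ t (g : Fin m → ℚ) →
      sumFin (λ w → q (suc t) w * g w) ≡ sumFin (λ v → alive t v * sumFin (λ w → P v w * g w))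
    forward-equation t g = begin
      sumFin (λ w → q (suc t) w * g w)                   ≡⟨ sumFin-cong (λ w → cong (_* g w) (q-suc t w)) ⟩
      sumFin (λ w → sumFin (λ v → X v w) * g w)          ≡⟨ sumFin-cong (λ w → sumFin-*ʳ (g w) (λ v → X v w)) ⟨
      sumFin (λ w → sumFin (λ v → X v w * g w))          ≡⟨ sumFin-comm (λ w v → X v w * g w) ⟩
      sumFin (λ v → sumFin (λ w → X v w * g w))          ≡⟨ sumFin-cong factor ⟩
      sumFin (λ v → alive t v * sumFin (λ w → P v w * g w)) ∎
      where
      open ≡-Reasoning
      X : Fin m → Fin m → ℚ
      X v w = if eqFin v l then 0ℚ else q t v * P v w
      factor : ∀ v → sumFin (λ w → X v w * g w) ≡ alive t v * sumFin (λ w → P v w * g w)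
      factor v with eqFin v l
      ... | true  = ≡.trans (sumFin-cong (λ w → *-zeroˡ (g w))) (≡.trans (sumFin-zero m) (sym (*-zeroˡ (sumFin (λ w → P v w * g w)))))
      ... | false = ≡.trans (sumFin-cong (λ w → *-assoc (q t v) (P v w) (g w))) (sumFin-*ˡ (q t v) (λ w → P v w * g w))

    total-suc : ∀ t → sumFin (q (suc t)) ≡ survival t
    total-suc t = begin
      sumFin (q (suc t))                                ≡⟨ sumFin-cong (λ w → *-identityʳ (q (suc t) w)) ⟨
      sumFin (λ w → q (suc t) w * 1ℚ)                   ≡⟨ forward-equation t (λ _ → 1ℚ) ⟩
      sumFin (λ v → alive t v * sumFin (λ w → P v w * 1ℚ)) ≡⟨ sumFin-cong (λ v → cong (alive t v *_) (row v)) ⟩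
      sumFin (λ v → alive t v * 1ℚ)                     ≡⟨ sumFin-cong (λ v → *-identityʳ (alive t v)) ⟩
      survival t                                        ∎
      where
      open ≡-Reasoning
      row : ∀ v → sumFin (λ w → P v w * 1ℚ) ≡ 1ℚ
      row v = ≡.trans (sumFin-cong (λ w → *-identityʳ (P v w))) (P-stochastic v)

    survival-suc : ∀ t → survival t ≡ survival (suc t) + q (suc t) l
    survival-suc t = ≡.trans (sym (total-suc t)) (sumFin-split l (q (suc t)))

    hit-mass : (M : ℕ → ℚ) → M 0 ≡ q 0 l → (∀ T → M (suc T) ≡ M T + q (suc T) l) →
      ∀ T → M T ≡ 1ℚ - survival T
    hit-mass M M₀ M-suc zero = begin
      M 0                             ≡⟨ M₀ ⟩
      q 0 l                           ≡⟨ solve 2 (λ s h → h := (s :+ h) :- s) refl (survival 0) (q 0 l) ⟩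
      (survival 0 + q 0 l) - survival 0 ≡⟨ cong (_- survival 0) (≡.trans (sym (sumFin-split l (q 0))) q₀-total) ⟩
      1ℚ - survival 0                 ∎
      where
      open ≡-Reasoning
      open +-*-Solver
    hit-mass M M₀ M-suc (suc T) = begin
      M (suc T)                                   ≡⟨ M-suc T ⟩
      M T + q (suc T) l                           ≡⟨ cong (_+ q (suc T) l) (hit-mass M M₀ M-suc T) ⟩
      (1ℚ - survival T) + q (suc T) l             ≡⟨ cong (λ s → (1ℚ - s) + q (suc T) l) (survival-suc T) ⟩
      (1ℚ - (survival (suc T) + q (suc T) l)) + q (suc T) l
                                                  ≡⟨ solve 2 (λ s h → (con 1ℚ :- (s :+ h)) :+ h := con 1ℚ :- s) refl (survival (suc T)) (q (suc T) l) ⟩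
      1ℚ - survival (suc T)                       ∎
      where
      open ≡-Reasoning
      open +-*-Solver

    module Potential (H : Fin m → ℚ) (b : ℕ)
      (H-target  : H l ≡ 0ℚ)
      (1≤H       : ∀ v → eqFin v l ≡ false → 1ℚ ≤ H v)
      (H≤B       : ∀ v → H v ≤ ι (suc b))
      (H-harmonic : ∀ v → eqFin v l ≡ false → sumFin (λ w → P v w * H w) ≡ H v - 1ℚ) where

      potential : ℕ → ℚ
      potential t = sumFin (λ w → q t w * H w)

      potential-alive : ∀ t → potential t ≡ sumFin (λ v → alive t v * H v)
      potential-alive t = begin
        potential t                                                   ≡⟨ sumFin-split l (λ w → q t w * H w) ⟩
        sumFin (λ v → if eqFin v l then 0ℚ else q t v * H v) + q t l * H l
                                                                      ≡⟨ cong₂ _+_ (sumFin-cong pull-out) (≡.trans (cong (q t l *_) H-target) (*-zeroʳ (q t l))) ⟩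
        sumFin (λ v → alive t v * H v) + 0ℚ                           ≡⟨ +-identityʳ _ ⟩
        sumFin (λ v → alive t v * H v)                                ∎
        where
        open ≡-Reasoning
        pull-out : ∀ v → (if eqFin v l then 0ℚ else q t v * H v) ≡ alive t v * H v
        pull-out v with eqFin v l
        ... | true  = sym (*-zeroˡ (H v))
        ... | false = refl

      potential-suc : ∀ t → potential (suc t) ≡ potential t - survival t
      potential-suc t = begin
        potential (suc t)                                          ≡⟨ forward-equation t H ⟩
        sumFin (λ v → alive t v * sumFin (λ w → P v w * H w))      ≡⟨ sumFin-cong step ⟩
        sumFin (λ v → alive t v * H v + - alive t v)               ≡⟨ sumFin-+ (λ v → alive t v * H v) (λ v → - alive t v) ⟩
        sumFin (λ v → alive t v * H v) + sumFin (λ v → - alive t v) ≡⟨ cong₂ _+_ (sym (potential-alive t)) negate ⟩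
        potential t - survival t                                   ∎
        where
        open ≡-Reasoning
        open +-*-Solver
        step : ∀ v → alive t v * sumFin (λ w → P v w * H w) ≡ alive t v * H v + - alive t v
        step v with eqFin v l in v≢l
        ... | true  = solve 2 (λ s h → con 0ℚ :* s := con 0ℚ :* h :+ :- con 0ℚ) refl (sumFin (λ w → P v w * H w)) (H v)
        ... | false = ≡.trans (cong (q t v *_) (H-harmonic v v≢l))
                        (solve 2 (λ a h → a :* (h :- con 1ℚ) := a :* h :+ :- a) refl (q t v) (H v))
        negate : sumFin (λ v → - alive t v) ≡ - survival t
        negate = begin
          sumFin (λ v → - alive t v)            ≡⟨ sumFin-cong (λ v → solve 1 (λ a → :- a := (:- con 1ℚ) :* a) refl (alive t v)) ⟩
          sumFin (λ v → - 1ℚ * alive t v)       ≡⟨ sumFin-*ˡ (- 1ℚ) (alive t) ⟩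
          - 1ℚ * survival t                     ≡⟨ solve 1 (λ s → (:- con 1ℚ) :* s := :- s) refl (survival t) ⟩
          - survival t                          ∎

      survival≤potential : ∀ t → survival t ≤ potential t
      survival≤potential t = ≤-trans (sumFin-mono-≤ pointwise) (≤-reflexive (sym (potential-alive t)))
        where
        pointwise : ∀ v → alive t v ≤ alive t v * H v
        pointwise v with eqFin v l in v≢l
        ... | true  = ≤-reflexive (sym (*-zeroˡ (H v)))
        ... | false = begin
          q t v          ≡⟨ *-identityʳ (q t v) ⟨
          q t v * 1ℚ     ≤⟨ *-monoˡ-≤-nonNeg (q t v) {{nonNegative (q-nonNeg t v)}} (1≤H v v≢l) ⟩
          q t v * H v    ∎
          where open ≤-Reasoning

      potential≤B·survival : ∀ t → potential t ≤ ι (suc b) * survival t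
      potential≤B·survival t = begin
        potential t                              ≡⟨ potential-alive t ⟩
        sumFin (λ v → alive t v * H v)           ≤⟨ sumFin-mono-≤ (λ v → *-monoˡ-≤-nonNeg (alive t v) {{nonNegative (alive-nonNeg t v)}} (H≤B v)) ⟩
        sumFin (λ v → alive t v * ι (suc b))     ≡⟨ sumFin-*ʳ (ι (suc b)) (alive t) ⟩
        survival t * ι (suc b)                   ≡⟨ *-comm (survival t) (ι (suc b)) ⟩
        ι (suc b) * survival t                   ∎
        where open ≤-Reasoning

      potential₀≤B : potential 0 ≤ ι (suc b)
      potential₀≤B = begin
        potential 0                              ≤⟨ sumFin-mono-≤ (λ w → *-monoˡ-≤-nonNeg (q 0 w) {{nonNegative (q₀-nonNeg w)}} (H≤B w)) ⟩
        sumFin (λ w → q 0 w * ι (suc b))         ≡⟨ sumFin-*ʳ (ι (suc b)) (q 0) ⟩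
        sumFin (q 0) * ι (suc b)                 ≡⟨ cong (_* ι (suc b)) q₀-total ⟩
        1ℚ * ι (suc b)                           ≡⟨ *-identityˡ (ι (suc b)) ⟩
        ι (suc b)                                ∎
        where open ≤-Reasoning

      0≤potential : ∀ t → 0ℚ ≤ potential t
      0≤potential t = ≤-trans (survival-nonNeg t) (survival≤potential t)

      -- Each surviving unit of mass pays one unit of potential per step, so E T + T·S T + R T is conserved.
      hit-mean : (E : ℕ → ℚ) → E 0 ≡ 0ℚ → (∀ T → E (suc T) ≡ E T + ι (suc T) * q (suc T) l) →
        ∀ T → E T + ι T * survival T + potential T ≡ potential 0
      hit-mean E E₀ E-suc zero = begin
        E 0 + ι 0 * survival 0 + potential 0     ≡⟨ cong (λ e → e + ι 0 * survival 0 + potential 0) E₀ ⟩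
        0ℚ + 0ℚ * survival 0 + potential 0       ≡⟨ solve 2 (λ s r → con 0ℚ :+ con 0ℚ :* s :+ r := r) refl (survival 0) (potential 0) ⟩
        potential 0                              ∎
        where
        open ≡-Reasoning
        open +-*-Solver
      hit-mean E E₀ E-suc (suc T) = begin
        E (suc T) + ι (suc T) * S′ + potential (suc T)
          ≡⟨ cong₂ (λ e r → e + ι (suc T) * S′ + r) (E-suc T) (potential-suc T) ⟩
        E T + ι (suc T) * h + ι (suc T) * S′ + (potential T - survival T)
          ≡⟨ cong₂ (λ x s → E T + x * h + x * S′ + (potential T - s)) (ι-homo-+ 1 T) (survival-suc T) ⟩
        E T + (1ℚ + ι T) * h + (1ℚ + ι T) * S′ + (potential T - (S′ + h))
          ≡⟨ solve 5 (λ e x h s r → e :+ (con 1ℚ :+ x) :* h :+ (con 1ℚ :+ x) :* s :+ (r :- (s :+ h)) := e :+ x :* (s :+ h) :+ r)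
               refl (E T) (ι T) h S′ (potential T) ⟩
        E T + ι T * (S′ + h) + potential T
          ≡⟨ cong (λ s → E T + ι T * s + potential T) (survival-suc T) ⟨
        E T + ι T * survival T + potential T
          ≡⟨ hit-mean E E₀ E-suc T ⟩
        potential 0 ∎
        where
        open ≡-Reasoning
        open +-*-Solver
        h S′ : ℚ
        h  = q (suc T) l
        S′ = survival (suc T)

      open QuadraticDecay b potential-suc potential≤B·survival 0≤potential potential₀≤B
        using ([1+T]R→0)

      hitting-time-converges : ∀ {h} → potential 0 ≡ h → (M E : ℕ → ℚ) →
        M 0 ≡ q 0 l → (∀ T → M (suc T) ≡ M T + q (suc T) l) →
        E 0 ≡ 0ℚ → (∀ T → E (suc T) ≡ E T + ι (suc T) * q (suc T) l) →
        ∀ ε → 0ℚ < ε → Σ ℕ (λ T₀ → (T : ℕ) → T₀ ℕ.≤ T → (∣ M T - 1ℚ ∣ < ε) × (∣ E T - h ∣ < ε))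
      hitting-time-converges {h} R₀≡h M E M₀ M-suc E₀ E-suc ε 0<ε =
        map₂ (λ small T T₀≤T → ≤-<-trans (mass-error T) (small T T₀≤T) , ≤-<-trans (mean-error T) (small T T₀≤T))
             ([1+T]R→0 ε 0<ε)
        where
        open +-*-Solver
        ∣-x∣≡x : ∀ x → 0ℚ ≤ x → ∣ - x ∣ ≡ x
        ∣-x∣≡x x 0≤x = ≡.trans (∣-p∣≡∣p∣ x) (0≤p⇒∣p∣≡p 0≤x)
        mass-error : ∀ T → ∣ M T - 1ℚ ∣ ≤ ι (suc T) * potential T
        mass-error T = begin
          ∣ M T - 1ℚ ∣                  ≡⟨ cong (λ x → ∣ x - 1ℚ ∣) (hit-mass M M₀ M-suc T) ⟩
          ∣ (1ℚ - survival T) - 1ℚ ∣    ≡⟨ cong ∣_∣ (solve 1 (λ s → (con 1ℚ :- s) :- con 1ℚ := :- s) refl (survival T)) ⟩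
          ∣ - survival T ∣              ≡⟨ ∣-x∣≡x (survival T) (survival-nonNeg T) ⟩
          survival T                    ≤⟨ survival≤potential T ⟩
          potential T                   ≡⟨ *-identityˡ (potential T) ⟨
          1ℚ * potential T              ≤⟨ *-monoʳ-≤-nonNeg (potential T) {{nonNegative (0≤potential T)}} (ι-mono-≤ {1} {suc T} (s≤s z≤n)) ⟩
          ι (suc T) * potential T       ∎
          where open ≤-Reasoning

        mean-error : ∀ T → ∣ E T - h ∣ ≤ ι (suc T) * potential T
        mean-error T = begin
          ∣ E T - h ∣                                       ≡⟨ cong (λ r → ∣ E T - r ∣) (≡.trans (hit-mean E E₀ E-suc T) R₀≡h) ⟨
          ∣ E T - (E T + ι T * survival T + potential T) ∣   ≡⟨ cong ∣_∣ (solve 3 (λ e y r → e :- (e :+ y :+ r) := :- (y :+ r)) refl (E T) (ι T * survival T) (potential T)) ⟩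
          ∣ - (ι T * survival T + potential T) ∣             ≡⟨ ∣-x∣≡x (ι T * survival T + potential T) (≤-trans (≤-reflexive (sym (+-identityʳ 0ℚ))) (+-mono-≤ 0≤TS (0≤potential T))) ⟩
          ι T * survival T + potential T                   ≤⟨ +-monoˡ-≤ (potential T) (*-monoˡ-≤-nonNeg (ι T) {{nonNegative (0≤ι T)}} (survival≤potential T)) ⟩
          ι T * potential T + potential T                  ≡⟨ solve 2 (λ x r → x :* r :+ r := (con 1ℚ :+ x) :* r) refl (ι T) (potential T) ⟩
          (1ℚ + ι T) * potential T                         ≡⟨ cong (_* potential T) (ι-homo-+ 1 T) ⟨
          ι (suc T) * potential T                          ∎
          where
          open ≤-Reasoning
          0≤TS : 0ℚ ≤ ι T * survival T
          0≤TS = nonNegative⁻¹ (ι T * survival T) {{nonNeg*nonNeg⇒nonNeg (ι T) {{nonNegative (0≤ι T)}} (survival T) {{nonNegative (survival-nonNeg T)}}}}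

  common-denominator : ∀ A B F → 0 ℕ.< F → frac 2 5 * (frac A 1 + frac B F) ≡ (frac 2 5 * frac 1 F) * ι (A ℕ.* F ℕ.+ B)
  common-denominator A B (suc b) _ = begin
    frac 2 5 * (ι A + frac B (suc b))                 ≡⟨ cong (λ x → frac 2 5 * (x + frac B (suc b))) unit ⟩
    frac 2 5 * (ι A * (i * ι (suc b)) + frac B (suc b)) ≡⟨ cong (λ x → frac 2 5 * (ι A * (i * ι (suc b)) + x)) (frac≡ι*frac B b) ⟩
    frac 2 5 * (ι A * (i * ι (suc b)) + ι B * i)      ≡⟨ solve 5 (λ t a i s x → t :* (a :* (i :* s) :+ x :* i) := (t :* i) :* (a :* s :+ x)) refl (frac 2 5) (ι A) i (ι (suc b)) (ι B) ⟩
    (frac 2 5 * i) * (ι A * ι (suc b) + ι B)          ≡⟨ cong (λ x → (frac 2 5 * i) * (x + ι B)) (ι-homo-* A (suc b)) ⟨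
    (frac 2 5 * i) * (ι (A ℕ.* suc b) + ι B)          ≡⟨ cong ((frac 2 5 * i) *_) (ι-homo-+ (A ℕ.* suc b) B) ⟨
    (frac 2 5 * i) * ι (A ℕ.* suc b ℕ.+ B)            ∎
    where
    open ≡-Reasoning
    open +-*-Solver
    i : ℚ
    i = frac 1 (suc b)
    unit : ι A ≡ ι A * (i * ι (suc b))
    unit = sym (≡.trans (cong (ι A *_) (/-*-cancel 1 b)) (*-identityʳ (ι A)))

  scale-cancel : ∀ F → 0 ℕ.< F → (frac 2 5 * frac 1 F) * ι F ≡ frac 2 5
  scale-cancel (suc b) _ = ≡.trans (*-assoc (frac 2 5) (frac 1 (suc b)) (ι (suc b)))
    (≡.trans (cong (frac 2 5 *_) (/-*-cancel 1 b)) (*-identityʳ (frac 2 5)))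

  -- Since c·F = 2/5, the 10F of the ℕ-identity becomes the constant 4 of the mean-value equation.
  four-point : ∀ c F q₀ q₁ q₃ q₄ q₂ → c * ι F ≡ frac 2 5 →
    q₀ ℕ.+ q₁ ℕ.+ q₃ ℕ.+ q₄ ℕ.+ 10 ℕ.* F ≡ 4 ℕ.* q₂ →
    c * ι q₀ + c * ι q₁ + c * ι q₃ + c * ι q₄ ≡ ι 4 * (c * ι q₂ - 1ℚ)
  four-point c F q₀ q₁ q₃ q₄ q₂ cF sum = begin
    c * ι q₀ + c * ι q₁ + c * ι q₃ + c * ι q₄
      ≡⟨ solve 7 (λ c a b d e t f → c :* a :+ c :* b :+ c :* d :+ c :* e := c :* ((a :+ b :+ d :+ e) :+ t :* f) :- t :* (c :* f))
           refl c (ι q₀) (ι q₁) (ι q₃) (ι q₄) (ι 10) (ι F) ⟩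
    c * ((ι q₀ + ι q₁ + ι q₃ + ι q₄) + ι 10 * ι F) - ι 10 * (c * ι F)
      ≡⟨ cong₂ (λ x y → c * x - ι 10 * y) cast-sum cF ⟩
    c * (ι 4 * ι q₂) - ι 10 * frac 2 5
      ≡⟨ solve 3 (λ c x y → c :* (x :* y) :- x := x :* (c :* y :- con 1ℚ)) refl c (ι 4) (ι q₂) ⟩
    ι 4 * (c * ι q₂ - 1ℚ) ∎
    where
    open ≡-Reasoning
    open +-*-Solver
    cast-sum : (ι q₀ + ι q₁ + ι q₃ + ι q₄) + ι 10 * ι F ≡ ι 4 * ι q₂
    cast-sum = begin
      (ι q₀ + ι q₁ + ι q₃ + ι q₄) + ι 10 * ι F   ≡⟨ cong₂ _+_ (cong₂ _+_ (cong₂ _+_ (ι-homo-+ q₀ q₁) refl) refl) refl ⟨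
      (ι (q₀ ℕ.+ q₁) + ι q₃ + ι q₄) + ι 10 * ι F ≡⟨ cong₂ _+_ (cong₂ _+_ (ι-homo-+ (q₀ ℕ.+ q₁) q₃) refl) refl ⟨
      (ι (q₀ ℕ.+ q₁ ℕ.+ q₃) + ι q₄) + ι 10 * ι F ≡⟨ cong₂ _+_ (ι-homo-+ (q₀ ℕ.+ q₁ ℕ.+ q₃) q₄) (ι-homo-* 10 F) ⟨
      ι (q₀ ℕ.+ q₁ ℕ.+ q₃ ℕ.+ q₄) + ι (10 ℕ.* F)  ≡⟨ ι-homo-+ (q₀ ℕ.+ q₁ ℕ.+ q₃ ℕ.+ q₄) (10 ℕ.* F) ⟨
      ι (q₀ ℕ.+ q₁ ℕ.+ q₃ ℕ.+ q₄ ℕ.+ 10 ℕ.* F)     ≡⟨ cong ι sum ⟩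
      ι (4 ℕ.* q₂)                                ≡⟨ ι-homo-* 4 q₂ ⟩
      ι 4 * ι q₂                                  ∎

  0≤frac : ∀ a b → 0ℚ ≤ frac a b
  0≤frac a zero    = ≤-refl
  0≤frac a (suc b) = nonNegative⁻¹ (frac a (suc b)) {{normalize-nonNeg a (suc b)}}

  module Formula (n : ℕ) where

    N F : ℕ
    N = 5 ℕ.+ n
    F = fib N

    c : ℚ
    c = frac 2 5 * frac 1 F

    c*F : c * ι F ≡ frac 2 5
    c*F = scale-cancel F (fib-pos (4 ℕ.+ n))

    formula≡Q : ∀ k k′ → N ℕ.∸ k ≡ k′ → formula N k ≡ c * ι (Q N F k k′)
    formula≡Q k k′ refl = common-denominator (k ℕ.* (N ℕ.∸ k)) (2 ℕ.* N ℕ.* fib k ℕ.* fib (N ℕ.∸ k)) F (fib-pos (4 ℕ.+ n))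

    formula-interior : ∀ s b → s ℕ.+ (4 ℕ.+ b) ≡ N →
      formula N s + formula N (1 ℕ.+ s) + formula N (3 ℕ.+ s) + formula N (4 ℕ.+ s) ≡ ι 4 * (formula N (2 ℕ.+ s) - 1ℚ)
    formula-interior s b s+4+b≡N = begin
      formula N s + formula N (1 ℕ.+ s) + formula N (3 ℕ.+ s) + formula N (4 ℕ.+ s)
        ≡⟨ cong₂ _+_ (cong₂ _+_ (cong₂ _+_ (formula≡Q s _ (co 0 4 refl)) (formula≡Q (1 ℕ.+ s) _ (co 1 3 refl)))
                                           (formula≡Q (3 ℕ.+ s) _ (co 3 1 refl))) (formula≡Q (4 ℕ.+ s) _ (co 4 0 refl)) ⟩
      c * ι (Q N F s (4 ℕ.+ b)) + c * ι (Q N F (1 ℕ.+ s) (3 ℕ.+ b)) + c * ι (Q N F (3 ℕ.+ s) (1 ℕ.+ b)) + c * ι (Q N F (4 ℕ.+ s) b)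
        ≡⟨ four-point c F (Q N F s (4 ℕ.+ b)) (Q N F (1 ℕ.+ s) (3 ℕ.+ b)) (Q N F (3 ℕ.+ s) (1 ℕ.+ b)) (Q N F (4 ℕ.+ s) b)
                     (Q N F (2 ℕ.+ s) (2 ℕ.+ b)) c*F (Q-interior N F s b) ⟩
      ι 4 * (c * ι (Q N F (2 ℕ.+ s) (2 ℕ.+ b)) - 1ℚ)
        ≡⟨ cong (λ x → ι 4 * (x - 1ℚ)) (formula≡Q (2 ℕ.+ s) _ (co 2 2 refl)) ⟨
      ι 4 * (formula N (2 ℕ.+ s) - 1ℚ) ∎
      where
      open ≡-Reasoning
      co : ∀ j j′ → j ℕ.+ j′ ≡ 4 → N ℕ.∸ (j ℕ.+ s) ≡ j′ ℕ.+ b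
      co j j′ j+j′≡4 = begin
        N ℕ.∸ (j ℕ.+ s)                             ≡⟨ cong (ℕ._∸ (j ℕ.+ s)) (≡.trans (sym s+4+b≡N) (regroup j j′ s b j+j′≡4)) ⟩
        (j ℕ.+ s) ℕ.+ (j′ ℕ.+ b) ℕ.∸ (j ℕ.+ s)       ≡⟨ ℕP.m+n∸m≡n (j ℕ.+ s) (j′ ℕ.+ b) ⟩
        j′ ℕ.+ b                                    ∎
        where
        regroup : ∀ j j′ s b → j ℕ.+ j′ ≡ 4 → s ℕ.+ (4 ℕ.+ b) ≡ (j ℕ.+ s) ℕ.+ (j′ ℕ.+ b)
        regroup j j′ s b j+j′≡4 = ≡.trans (cong (λ x → s ℕ.+ (x ℕ.+ b)) (sym j+j′≡4)) (shuffle j j′ s b)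
          where
          shuffle : ∀ j j′ s b → s ℕ.+ ((j ℕ.+ j′) ℕ.+ b) ≡ (j ℕ.+ s) ℕ.+ (j′ ℕ.+ b)
          shuffle = solve-∀

    formula-at-1 : formula N (4 ℕ.+ n) + formula N 0 + formula N 2 + formula N 3 ≡ ι 4 * (formula N 1 - 1ℚ)
    formula-at-1 = begin
      formula N (4 ℕ.+ n) + formula N 0 + formula N 2 + formula N 3
        ≡⟨ cong₂ _+_ (cong₂ _+_ (cong₂ _+_ (formula≡Q (4 ℕ.+ n) 1 (ℕP.m+n∸n≡m 1 n)) (formula≡Q 0 N refl))
                                (formula≡Q 2 (3 ℕ.+ n) refl)) (formula≡Q 3 (2 ℕ.+ n) refl) ⟩
      c * ι (Q N F (4 ℕ.+ n) 1) + c * ι (Q N F 0 N) + c * ι (Q N F 2 (3 ℕ.+ n)) + c * ι (Q N F 3 (2 ℕ.+ n))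
        ≡⟨ four-point c F (Q N F (4 ℕ.+ n) 1) (Q N F 0 N) (Q N F 2 (3 ℕ.+ n)) (Q N F 3 (2 ℕ.+ n)) (Q N F 1 (4 ℕ.+ n)) c*F (Q-at-1 n) ⟩
      ι 4 * (c * ι (Q N F 1 (4 ℕ.+ n)) - 1ℚ)
        ≡⟨ cong (λ x → ι 4 * (x - 1ℚ)) (formula≡Q 1 (4 ℕ.+ n) refl) ⟨
      ι 4 * (formula N 1 - 1ℚ) ∎
      where open ≡-Reasoning

    formula-at-N-1 : formula N (2 ℕ.+ n) + formula N (3 ℕ.+ n) + formula N 0 + formula N 1 ≡ ι 4 * (formula N (4 ℕ.+ n) - 1ℚ)
    formula-at-N-1 = begin
      formula N (2 ℕ.+ n) + formula N (3 ℕ.+ n) + formula N 0 + formula N 1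
        ≡⟨ cong₂ _+_ (cong₂ _+_ (cong₂ _+_ (formula≡Q (2 ℕ.+ n) 3 (ℕP.m+n∸n≡m 3 n)) (formula≡Q (3 ℕ.+ n) 2 (ℕP.m+n∸n≡m 2 n)))
                                (formula≡Q 0 N refl)) (formula≡Q 1 (4 ℕ.+ n) refl) ⟩
      c * ι (Q N F (2 ℕ.+ n) 3) + c * ι (Q N F (3 ℕ.+ n) 2) + c * ι (Q N F 0 N) + c * ι (Q N F 1 (4 ℕ.+ n))
        ≡⟨ four-point c F (Q N F (2 ℕ.+ n) 3) (Q N F (3 ℕ.+ n) 2) (Q N F 0 N) (Q N F 1 (4 ℕ.+ n)) (Q N F (4 ℕ.+ n) 1) c*F (Q-at-N-1 n) ⟩
      ι 4 * (c * ι (Q N F (4 ℕ.+ n) 1) - 1ℚ)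
        ≡⟨ cong (λ x → ι 4 * (x - 1ℚ)) (formula≡Q (4 ℕ.+ n) 1 (ℕP.m+n∸n≡m 1 n)) ⟨
      ι 4 * (formula N (4 ℕ.+ n) - 1ℚ) ∎
      where open ≡-Reasoning

    formula-zero : formula N 0 ≡ 0ℚ
    formula-zero = ≡.trans (formula≡Q 0 N refl) (≡.trans (cong (λ x → c * ι x) (Q-zeroˡ N F N)) (*-zeroʳ c))

    formula-N : formula N N ≡ 0ℚ
    formula-N = ≡.trans (formula≡Q N 0 (ℕP.n∸n≡0 N)) (≡.trans (cong (λ x → c * ι x) (Q-zeroʳ N F N)) (*-zeroʳ c))

    formula-sym : ∀ k → k ℕ.≤ N → formula N (N ℕ.∸ k) ≡ formula N k
    formula-sym k k≤N = begin
      formula N (N ℕ.∸ k)                 ≡⟨ formula≡Q (N ℕ.∸ k) k (ℕP.m∸[m∸n]≡n k≤N) ⟩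
      c * ι (Q N F (N ℕ.∸ k) k)           ≡⟨ cong (λ x → c * ι x) (Q-comm N F (N ℕ.∸ k) k) ⟩
      c * ι (Q N F k (N ℕ.∸ k))           ≡⟨ formula≡Q k (N ℕ.∸ k) refl ⟨
      formula N k                         ∎
      where open ≡-Reasoning

    private
      c-nonNeg : NonNegative c
      c-nonNeg = nonNeg*nonNeg⇒nonNeg (frac 2 5) {{normalize-nonNeg 2 5}} (frac 1 F) {{nonNegative (0≤frac 1 F)}}

      c*ι-mono-≤ : ∀ {a b} → a ℕ.≤ b → c * ι a ≤ c * ι b
      c*ι-mono-≤ a≤b = *-monoˡ-≤-nonNeg c {{c-nonNeg}} (ι-mono-≤ a≤b)

      c*ι[m*F] : ∀ m → c * ι (m ℕ.* F) ≡ ι m * frac 2 5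
      c*ι[m*F] m = begin
        c * ι (m ℕ.* F)     ≡⟨ cong (c *_) (ι-homo-* m F) ⟩
        c * (ι m * ι F)     ≡⟨ solve 3 (λ c x f → c :* (x :* f) := x :* (c :* f)) refl c (ι m) (ι F) ⟩
        ι m * (c * ι F)     ≡⟨ cong (ι m *_) c*F ⟩
        ι m * frac 2 5      ∎
        where
        open ≡-Reasoning
        open +-*-Solver

    0≤formula : ∀ k → 0ℚ ≤ formula N k
    0≤formula k = ≤-trans (nonNegative⁻¹ (c * ι Qk) {{nonNeg*nonNeg⇒nonNeg c {{c-nonNeg}} (ι Qk) {{nonNegative (0≤ι Qk)}}}})
                          (≤-reflexive (sym (formula≡Q k (N ℕ.∸ k) refl)))
      where Qk = Q N F k (N ℕ.∸ k)

    bound : ℕ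
    bound = N ℕ.* N ℕ.+ 2 ℕ.* N

    formula≤bound : ∀ k → k ℕ.≤ N → formula N k ≤ ι bound
    formula≤bound k k≤N = begin
      formula N k                      ≡⟨ formula≡Q k (N ℕ.∸ k) refl ⟩
      c * ι (Q N F k (N ℕ.∸ k))        ≤⟨ c*ι-mono-≤ (Q-≤ N k (N ℕ.∸ k) (ℕP.m+[n∸m]≡n k≤N)) ⟩
      c * ι (bound ℕ.* F)              ≡⟨ c*ι[m*F] bound ⟩
      ι bound * frac 2 5               ≤⟨ *-monoˡ-≤-nonNeg (ι bound) {{nonNegative (0≤ι bound)}} (≤ᵇ⇒≤ tt) ⟩
      ι bound * 1ℚ                     ≡⟨ *-identityʳ (ι bound) ⟩
      ι bound                          ∎
      where open ≤-Reasoning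

    1≤formula : ∀ k → 0 ℕ.< k → k ℕ.< N → 1ℚ ≤ formula N k
    1≤formula (suc a) _ k<N with b , 2+a+b≡N ← ℕP.m≤n⇒∃[o]m+o≡n k<N = begin
      1ℚ                                  ≤⟨ ≤ᵇ⇒≤ tt ⟩
      ι 4 * frac 2 5                      ≤⟨ *-monoʳ-≤-nonNeg (frac 2 5) {{normalize-nonNeg 2 5}} (ι-mono-≤ (ℕP.m≤m+n 4 n)) ⟩
      ι (N ℕ.∸ 1) * frac 2 5              ≡⟨ c*ι[m*F] (N ℕ.∸ 1) ⟨
      c * ι ((N ℕ.∸ 1) ℕ.* F)             ≤⟨ c*ι-mono-≤ (Q-≥ N F a b 2+a+b≡N) ⟩
      c * ι (Q N F (suc a) (suc b))       ≡⟨ formula≡Q (suc a) (suc b) complement ⟨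
      formula N (suc a)                   ∎
      where
      open ≤-Reasoning
      complement : N ℕ.∸ suc a ≡ suc b
      complement = ≡.trans (cong (ℕ._∸ suc a) (sym (≡.trans (cong suc (ℕP.+-suc a b)) 2+a+b≡N))) (ℕP.m+n∸m≡n (suc a) (suc b))

  -- Sums over the neighbours of a vertex of C_N^2

  Periodic : ℕ → (ℕ → ℚ) → Set
  Periodic N g = ∀ x → g (x ℕ.+ N) ≡ g x

  sumFin-at : ∀ N m (g : ℕ → ℚ) → sumFin {N} (λ i → ind (toℕ i ≡ᵇ m) (g (toℕ i))) ≡ ind (m <ᵇ N) (g m)
  sumFin-at zero    m       g = refl
  sumFin-at (suc N) zero    g = ≡.trans (cong (g 0 +_) (sumFin-zero N)) (+-identityʳ (g 0))
  sumFin-at (suc N) (suc m) g = ≡.trans (+-identityˡ _) (sumFin-at N m (g ∘ suc))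

  sumFin-at-offset : ∀ {N} e v (g : ℕ → ℚ) → v ℕ.< N →
    sumFin {N} (λ i → ind (e ℕ.+ toℕ i ≡ᵇ v) (g (toℕ i))) ≡ ind (e <ᵇ suc v) (g (v ℕ.∸ e))
  sumFin-at-offset {N} zero    v       g v<N = ≡.trans (sumFin-at N v g) (cong (λ b → ind b (g v)) (dec-true (v ℕP.<? N) v<N))
  sumFin-at-offset {N} (suc e) zero    g _   = sumFin-zero N
  sumFin-at-offset {N} (suc e) (suc v) g v<N = sumFin-at-offset e v g (ℕP.<-trans (ℕP.n<1+n v) v<N)

  ind-absdiff : ∀ v i d x → ind (absdiff v i ≡ᵇ suc d) x ≡ ind (i ≡ᵇ v ℕ.+ suc d) x + ind (i ℕ.+ suc d ≡ᵇ v) x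
  ind-absdiff zero    zero    d x = sym (+-identityˡ 0ℚ)
  ind-absdiff zero    (suc i) d x = sym (+-identityʳ _)
  ind-absdiff (suc v) zero    d x = ≡.trans (cong (λ k → ind (k ≡ᵇ d) x) (ℕP.+-identityʳ v))
                                            (≡.trans (cong (λ b → ind b x) (≡ᵇ-comm v d)) (sym (+-identityˡ _)))
    where
    ≡ᵇ-comm : ∀ m n → (m ≡ᵇ n) ≡ (n ≡ᵇ m)
    ≡ᵇ-comm zero    zero    = refl
    ≡ᵇ-comm zero    (suc n) = refl
    ≡ᵇ-comm (suc m) zero    = refl
    ≡ᵇ-comm (suc m) (suc n) = ≡ᵇ-comm m n
  ind-absdiff (suc v) (suc i) d x = ind-absdiff v i d x

  sumFin-absdiff : ∀ {N} d v (g : ℕ → ℚ) → v ℕ.< N →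
    sumFin {N} (λ i → ind (absdiff v (toℕ i) ≡ᵇ suc d) (g (toℕ i)))
      ≡ ind (v ℕ.+ suc d <ᵇ N) (g (v ℕ.+ suc d)) + ind (d <ᵇ v) (g (v ℕ.∸ suc d))
  sumFin-absdiff {N} d v g v<N = begin
    sumFin {N} (λ i → ind (absdiff v (toℕ i) ≡ᵇ suc d) (g (toℕ i)))
      ≡⟨ sumFin-cong {N} (λ i → ind-absdiff v (toℕ i) d (g (toℕ i))) ⟩
    sumFin {N} (λ i → ind (toℕ i ≡ᵇ v ℕ.+ suc d) (g (toℕ i)) + ind (toℕ i ℕ.+ suc d ≡ᵇ v) (g (toℕ i)))
      ≡⟨ sumFin-+ {N} _ _ ⟩
    sumFin {N} (λ i → ind (toℕ i ≡ᵇ v ℕ.+ suc d) (g (toℕ i))) + sumFin {N} (λ i → ind (toℕ i ℕ.+ suc d ≡ᵇ v) (g (toℕ i)))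
      ≡⟨ cong₂ _+_ (sumFin-at N (v ℕ.+ suc d) g)
                   (≡.trans (sumFin-cong {N} (λ i → cong (λ k → ind (k ≡ᵇ v) (g (toℕ i))) (ℕP.+-comm (toℕ i) (suc d))))
                            (sumFin-at-offset {N} (suc d) v g v<N)) ⟩
    ind (v ℕ.+ suc d <ᵇ N) (g (v ℕ.+ suc d)) + ind (d <ᵇ v) (g (v ℕ.∸ suc d)) ∎
    where open ≡-Reasoning

  wrap-pair : ∀ {N} d e v (g : ℕ → ℚ) → Periodic N g → d ℕ.+ e ≡ N →
    ind (v ℕ.+ d <ᵇ N) (g (v ℕ.+ d)) + ind (e <ᵇ suc v) (g (v ℕ.∸ e)) ≡ g (v ℕ.+ d)
  wrap-pair {N} d e v g periodic d+e≡N with v ℕ.+ d ℕP.<? N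
  ... | yes v+d<N = begin
    ind (v ℕ.+ d <ᵇ N) (g (v ℕ.+ d)) + ind (e <ᵇ suc v) (g (v ℕ.∸ e))
      ≡⟨ cong₂ (λ b b′ → ind b (g (v ℕ.+ d)) + ind b′ (g (v ℕ.∸ e))) (dec-true (v ℕ.+ d ℕP.<? N) v+d<N) (dec-false (e ℕP.<? suc v) e≰v) ⟩
    g (v ℕ.+ d) + 0ℚ
      ≡⟨ +-identityʳ (g (v ℕ.+ d)) ⟩
    g (v ℕ.+ d) ∎
    where
    open ≡-Reasoning
    e≰v : ¬ e ℕ.< suc v
    e≰v (s≤s e≤v) = ℕP.<-irrefl refl (ℕP.<-≤-trans v+d<N (ℕP.≤-trans (ℕP.≤-reflexive (sym d+e≡N))
                                     (ℕP.≤-trans (ℕP.+-monoʳ-≤ d e≤v) (ℕP.≤-reflexive (ℕP.+-comm d v)))))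
  ... | no v+d≮N = begin
    ind (v ℕ.+ d <ᵇ N) (g (v ℕ.+ d)) + ind (e <ᵇ suc v) (g (v ℕ.∸ e))
      ≡⟨ cong₂ (λ b b′ → ind b (g (v ℕ.+ d)) + ind b′ (g (v ℕ.∸ e))) (dec-false (v ℕ.+ d ℕP.<? N) v+d≮N) (dec-true (e ℕP.<? suc v) (s≤s e≤v)) ⟩
    0ℚ + g (v ℕ.∸ e)          ≡⟨ +-identityˡ (g (v ℕ.∸ e)) ⟩
    g (v ℕ.∸ e)               ≡⟨ periodic (v ℕ.∸ e) ⟨
    g (v ℕ.∸ e ℕ.+ N)         ≡⟨ cong g unwrap ⟩
    g (v ℕ.+ d)               ∎
    where
    open ≡-Reasoning
    e≤v : e ℕ.≤ v
    e≤v = ℕP.+-cancelˡ-≤ d e v (ℕP.≤-trans (ℕP.≤-reflexive d+e≡N)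
            (ℕP.≤-trans (ℕP.≮⇒≥ v+d≮N) (ℕP.≤-reflexive (ℕP.+-comm v d))))
    unwrap : v ℕ.∸ e ℕ.+ N ≡ v ℕ.+ d
    unwrap = begin
      v ℕ.∸ e ℕ.+ N              ≡⟨ cong (v ℕ.∸ e ℕ.+_) (≡.trans (sym d+e≡N) (ℕP.+-comm d e)) ⟩
      v ℕ.∸ e ℕ.+ (e ℕ.+ d)      ≡⟨ ℕP.+-assoc (v ℕ.∸ e) e d ⟨
      v ℕ.∸ e ℕ.+ e ℕ.+ d        ≡⟨ cong (ℕ._+ d) (ℕP.m∸n+n≡m e≤v) ⟩
      v ℕ.+ d                    ∎

  pair-sum : ∀ {N} d e v (g : ℕ → ℚ) → Periodic N g → suc d ℕ.+ suc e ≡ N → v ℕ.< N →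
    sumFin {N} (λ i → ind (absdiff v (toℕ i) ≡ᵇ suc d) (g (toℕ i)))
      + sumFin {N} (λ i → ind (absdiff v (toℕ i) ≡ᵇ suc e) (g (toℕ i)))
      ≡ g (v ℕ.+ suc d) + g (v ℕ.+ suc e)
  pair-sum {N} d e v g periodic d+e≡N v<N = begin
    sumFin {N} (λ i → ind (absdiff v (toℕ i) ≡ᵇ suc d) (g (toℕ i)))
      + sumFin {N} (λ i → ind (absdiff v (toℕ i) ≡ᵇ suc e) (g (toℕ i)))
      ≡⟨ cong₂ _+_ (sumFin-absdiff d v g v<N) (sumFin-absdiff e v g v<N) ⟩
    (up d + down d) + (up e + down e)
      ≡⟨ solve 4 (λ a b c d → (a :+ b) :+ (c :+ d) := (a :+ d) :+ (c :+ b)) refl (up d) (down d) (up e) (down e) ⟩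
    (up d + down e) + (up e + down d)
      ≡⟨ cong₂ _+_ (wrap-pair (suc d) (suc e) v g periodic d+e≡N)
                   (wrap-pair (suc e) (suc d) v g periodic (≡.trans (ℕP.+-comm (suc e) (suc d)) d+e≡N)) ⟩
    g (v ℕ.+ suc d) + g (v ℕ.+ suc e) ∎
    where
    open ≡-Reasoning
    open +-*-Solver
    up down : ℕ → ℚ
    up   k = ind (v ℕ.+ suc k <ᵇ N) (g (v ℕ.+ suc k))
    down k = ind (k <ᵇ v) (g (v ℕ.∸ suc k))

  -- For N ≥ 5 the four distances 1, 2, N - 1, N - 2 are distinct.
  ind-adjacent : ∀ n x y →
    ind ((x ≡ᵇ 1) ∨ (x ≡ᵇ 2) ∨ (x ≡ᵇ 4 ℕ.+ n) ∨ (x ≡ᵇ 3 ℕ.+ n)) y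
      ≡ (ind (x ≡ᵇ 1) y + ind (x ≡ᵇ 4 ℕ.+ n) y) + (ind (x ≡ᵇ 2) y + ind (x ≡ᵇ 3 ℕ.+ n) y)
  ind-adjacent n zero                y = refl
  ind-adjacent n (suc zero)          y = solve 1 (λ y → y := (y :+ con 0ℚ) :+ (con 0ℚ :+ con 0ℚ)) refl y
    where open +-*-Solver
  ind-adjacent n (suc (suc zero))    y = solve 1 (λ y → y := (con 0ℚ :+ con 0ℚ) :+ (y :+ con 0ℚ)) refl y
    where open +-*-Solver
  ind-adjacent n (suc (suc (suc x))) y with x ≡ᵇ suc n in x≡1+n | x ≡ᵇ n in x≡n
  ... | true  | true  = ⊥-elim (ℕP.1+n≢n (≡.trans (sym (ℕP.≡ᵇ⇒≡ x (suc n) (subst T (sym x≡1+n) tt)))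
                                                    (ℕP.≡ᵇ⇒≡ x n (subst T (sym x≡n) tt))))
  ... | true  | false = solve 1 (λ y → y := (con 0ℚ :+ y) :+ (con 0ℚ :+ con 0ℚ)) refl y
    where open +-*-Solver
  ... | false | b     = sym (≡.trans (+-identityˡ _) (+-identityˡ (ind b y)))

  module Cycle (n : ℕ) where

    N : ℕ
    N = 5 ℕ.+ n

    neighbour-sum : ∀ (u : Fin N) (g : ℕ → ℚ) → Periodic N g →
      sumFin (λ w → ind (adj N u w) (g (toℕ w)))
        ≡ (g (toℕ u ℕ.+ 1) + g (toℕ u ℕ.+ (4 ℕ.+ n))) + (g (toℕ u ℕ.+ 2) + g (toℕ u ℕ.+ (3 ℕ.+ n)))
    neighbour-sum u g periodic = begin
      sumFin (λ w → ind (adj N u w) (g (toℕ w)))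
        ≡⟨ sumFin-cong {N} (λ w → ind-adjacent n (absdiff v (toℕ w)) (g (toℕ w))) ⟩
      sumFin (λ w → (D 1 w + D (4 ℕ.+ n) w) + (D 2 w + D (3 ℕ.+ n) w))
        ≡⟨ sumFin-+ (λ w → D 1 w + D (4 ℕ.+ n) w) (λ w → D 2 w + D (3 ℕ.+ n) w) ⟩
      sumFin (λ w → D 1 w + D (4 ℕ.+ n) w) + sumFin (λ w → D 2 w + D (3 ℕ.+ n) w)
        ≡⟨ cong₂ _+_ (sumFin-+ (D 1) (D (4 ℕ.+ n))) (sumFin-+ (D 2) (D (3 ℕ.+ n))) ⟩
      (sumFin (D 1) + sumFin (D (4 ℕ.+ n))) + (sumFin (D 2) + sumFin (D (3 ℕ.+ n)))
        ≡⟨ cong₂ _+_ (pair-sum 0 (3 ℕ.+ n) v g periodic refl (toℕ<n u)) (pair-sum 1 (2 ℕ.+ n) v g periodic refl (toℕ<n u)) ⟩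
      (g (v ℕ.+ 1) + g (v ℕ.+ (4 ℕ.+ n))) + (g (v ℕ.+ 2) + g (v ℕ.+ (3 ℕ.+ n))) ∎
      where
      open ≡-Reasoning
      v : ℕ
      v = toℕ u
      D : ℕ → Fin N → ℚ
      D k w = ind (absdiff v (toℕ w) ≡ᵇ k) (g (toℕ w))

    adjacent-count : ∀ u → sumFin (λ w → ind (adj N u w) 1ℚ) ≡ ι 4
    adjacent-count u = neighbour-sum u (λ _ → 1ℚ) (λ _ → refl)

    deg≡4 : ∀ u → deg N u ≡ 4
    deg≡4 u = ι-injective (≡.trans (ι-countFin (adj N u)) (adjacent-count u))

    trans≡ind : ∀ v w → trans N v w ≡ frac 1 4 * ind (adj N v w) 1ℚ
    trans≡ind v w with adj N v w
    ... | true  = cong (frac 1) (deg≡4 v)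
    ... | false = refl

    trans-nonNeg : ∀ v w → 0ℚ ≤ trans N v w
    trans-nonNeg v w with adj N v w
    ... | true  = 0≤frac 1 (deg N v)
    ... | false = ≤-refl

    trans-stochastic : ∀ v → sumFin (trans N v) ≡ 1ℚ
    trans-stochastic v = begin
      sumFin (trans N v)                               ≡⟨ sumFin-cong (trans≡ind v) ⟩
      sumFin (λ w → frac 1 4 * ind (adj N v w) 1ℚ)     ≡⟨ sumFin-*ˡ (frac 1 4) (λ w → ind (adj N v w) 1ℚ) ⟩
      frac 1 4 * sumFin (λ w → ind (adj N v w) 1ℚ)     ≡⟨ cong (frac 1 4 *_) (adjacent-count v) ⟩
      frac 1 4 * ι 4                                   ≡⟨⟩
      1ℚ                                               ∎
      where open ≡-Reasoning

    trans-average : ∀ v (g : ℕ → ℚ) → Periodic N g →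
      sumFin (λ w → trans N v w * g (toℕ w))
        ≡ frac 1 4 * ((g (toℕ v ℕ.+ 1) + g (toℕ v ℕ.+ (4 ℕ.+ n))) + (g (toℕ v ℕ.+ 2) + g (toℕ v ℕ.+ (3 ℕ.+ n))))
    trans-average v g periodic = begin
      sumFin (λ w → trans N v w * g (toℕ w))                 ≡⟨ sumFin-cong pointwise ⟩
      sumFin (λ w → frac 1 4 * ind (adj N v w) (g (toℕ w)))   ≡⟨ sumFin-*ˡ (frac 1 4) (λ w → ind (adj N v w) (g (toℕ w))) ⟩
      frac 1 4 * sumFin (λ w → ind (adj N v w) (g (toℕ w)))   ≡⟨ cong (frac 1 4 *_) (neighbour-sum v g periodic) ⟩
      _ ∎
      where
      open ≡-Reasoning
      pointwise : ∀ w → trans N v w * g (toℕ w) ≡ frac 1 4 * ind (adj N v w) (g (toℕ w))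
      pointwise w with adj N v w
      ... | true  = cong (λ d → frac 1 d * g (toℕ w)) (deg≡4 v)
      ... | false = ≡.trans (*-zeroˡ (g (toℕ w))) (sym (*-zeroʳ (frac 1 4)))

  residue-≢0 : ∀ {N L v} .{{_ : ℕ.NonZero N}} → L ℕ.< N → v ℕ.< N → v ≢ L → (v ℕ.+ (N ℕ.∸ L)) % N ≢ 0
  residue-≢0 {N} {L} {v} L<N v<N v≢L residue≡0 with ℕP.≤-<-connex L v
  ... | inj₁ L≤v = v≢L (ℕP.≤-antisym (ℕP.m∸n≡0⇒m≤n (≡.trans (sym (m<n⇒m%n≡m v∸L<N)) (≡.trans (sym ([m+n]%n≡m%n (v ℕ.∸ L) N)) (≡.trans (sym (%-congˡ shift)) residue≡0)))) L≤v)
    where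
    v∸L<N : v ℕ.∸ L ℕ.< N
    v∸L<N = ℕP.≤-<-trans (ℕP.m∸n≤m v L) v<N
    shift : v ℕ.+ (N ℕ.∸ L) ≡ v ℕ.∸ L ℕ.+ N
    shift = begin
      v ℕ.+ (N ℕ.∸ L)                ≡⟨ cong (ℕ._+ (N ℕ.∸ L)) (ℕP.m∸n+n≡m L≤v) ⟨
      v ℕ.∸ L ℕ.+ L ℕ.+ (N ℕ.∸ L)     ≡⟨ ℕP.+-assoc (v ℕ.∸ L) L (N ℕ.∸ L) ⟩
      v ℕ.∸ L ℕ.+ (L ℕ.+ (N ℕ.∸ L))   ≡⟨ cong (v ℕ.∸ L ℕ.+_) (ℕP.m+[n∸m]≡n (ℕP.<⇒≤ L<N)) ⟩
      v ℕ.∸ L ℕ.+ N                   ∎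
      where open ≡-Reasoning
  ... | inj₂ v<L = ℕP.<⇒≢ (ℕP.<-≤-trans (ℕP.m<n⇒0<n∸m L<N) (ℕP.m≤n+m (N ℕ.∸ L) v))
                          (≡.trans (sym residue≡0) (m<n⇒m%n≡m sum<N))
    where
    sum<N : v ℕ.+ (N ℕ.∸ L) ℕ.< N
    sum<N = ℕP.<-≤-trans (ℕP.+-monoˡ-< (N ℕ.∸ L) v<L) (ℕP.≤-reflexive (ℕP.m+[n∸m]≡n (ℕP.<⇒≤ L<N)))

  module Harmonic (n : ℕ) where
    open Formula n
    open Cycle n using (trans-average)

    φ : ℕ → ℚ
    φ x = formula N (x % N)

    φ-periodic : Periodic N φ
    φ-periodic x = cong (formula N) ([m+n]%n≡m%n x N)

    φ-N : φ N ≡ formula N 0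
    φ-N = cong (formula N) (n%n≡0 N)

    φ-≤ : ∀ j → j ℕ.≤ N → φ j ≡ formula N j
    φ-≤ j j≤N with ℕP.m≤n⇒m<n∨m≡n j≤N
    ... | inj₁ j<N = cong (formula N) (m<n⇒m%n≡m j<N)
    ... | inj₂ refl = ≡.trans φ-N (≡.trans formula-zero (sym formula-N))

    φ-mod : ∀ w k → φ (w ℕ.+ k) ≡ φ (w % N ℕ.+ k)
    φ-mod w k = cong (formula N) (≡.trans (%-distribˡ-+ w k N)
      (sym (≡.trans (%-distribˡ-+ (w % N) k N) (cong (λ x → (x ℕ.+ k % N) % N) (m%n%n≡m%n w N)))))

    φ-back : ∀ r k → k ℕ.≤ r → k ℕ.≤ N → φ (r ℕ.+ (N ℕ.∸ k)) ≡ φ (r ℕ.∸ k)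
    φ-back r k k≤r k≤N = ≡.trans (cong φ unwrap) (φ-periodic (r ℕ.∸ k))
      where
      open ≡-Reasoning
      unwrap : r ℕ.+ (N ℕ.∸ k) ≡ r ℕ.∸ k ℕ.+ N
      unwrap = begin
        r ℕ.+ (N ℕ.∸ k)               ≡⟨ cong (ℕ._+ (N ℕ.∸ k)) (ℕP.m∸n+n≡m k≤r) ⟨
        r ℕ.∸ k ℕ.+ k ℕ.+ (N ℕ.∸ k)   ≡⟨ ℕP.+-assoc (r ℕ.∸ k) k (N ℕ.∸ k) ⟩
        r ℕ.∸ k ℕ.+ (k ℕ.+ (N ℕ.∸ k)) ≡⟨ cong (r ℕ.∸ k ℕ.+_) (ℕP.m+[n∸m]≡n k≤N) ⟩
        r ℕ.∸ k ℕ.+ N                 ∎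

    φ-forward : ∀ r k → φ (r ℕ.+ k) ≡ φ (k ℕ.+ r)
    φ-forward r k = cong φ (ℕP.+-comm r k)

    Mean-value : ℕ → Set
    Mean-value r = φ (r ℕ.+ (3 ℕ.+ n)) + φ (r ℕ.+ (4 ℕ.+ n)) + φ (r ℕ.+ 1) + φ (r ℕ.+ 2) ≡ ι 4 * (formula N r - 1ℚ)

    mean-value-at-1 : Mean-value 1
    mean-value-at-1 = begin
      φ (4 ℕ.+ n) + φ N + φ 2 + φ 3
        ≡⟨ cong₂ _+_ (cong₂ _+_ (cong₂ _+_ (φ-≤ (4 ℕ.+ n) (ℕP.n≤1+n _)) φ-N) (φ-≤ 2 (s≤s (s≤s z≤n)))) (φ-≤ 3 (s≤s (s≤s (s≤s z≤n)))) ⟩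
      formula N (4 ℕ.+ n) + formula N 0 + formula N 2 + formula N 3
        ≡⟨ formula-at-1 ⟩
      ι 4 * (formula N 1 - 1ℚ) ∎
      where open ≡-Reasoning

    mean-value-interior : ∀ s b → s ℕ.+ b ≡ suc n → Mean-value (2 ℕ.+ s)
    mean-value-interior s b s+b≡1+n = begin
      φ (r ℕ.+ (3 ℕ.+ n)) + φ (r ℕ.+ (4 ℕ.+ n)) + φ (r ℕ.+ 1) + φ (r ℕ.+ 2)
        ≡⟨ cong₂ _+_ (cong₂ _+_ (cong₂ _+_ (φ-back r 2 (s≤s (s≤s z≤n)) (s≤s (s≤s z≤n))) (φ-back r 1 (s≤s z≤n) (s≤s z≤n)))
                                (φ-forward r 1)) (φ-forward r 2) ⟩
      φ s + φ (1 ℕ.+ s) + φ (3 ℕ.+ s) + φ (4 ℕ.+ s)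
        ≡⟨ cong₂ _+_ (cong₂ _+_ (cong₂ _+_ (φ-≤ s (in-range 0 z≤n)) (φ-≤ (1 ℕ.+ s) (in-range 1 (ℕP.m≤m+n 1 3))))
                                           (φ-≤ (3 ℕ.+ s) (in-range 3 (ℕP.n≤1+n 3)))) (φ-≤ (4 ℕ.+ s) (in-range 4 ℕP.≤-refl)) ⟩
      formula N s + formula N (1 ℕ.+ s) + formula N (3 ℕ.+ s) + formula N (4 ℕ.+ s)
        ≡⟨ formula-interior s b s+4+b≡N ⟩
      ι 4 * (formula N r - 1ℚ) ∎
      where
      open ≡-Reasoning
      r : ℕ
      r = 2 ℕ.+ s
      s+4+b≡N : s ℕ.+ (4 ℕ.+ b) ≡ N
      s+4+b≡N = ≡.trans (regroup s b) (cong (4 ℕ.+_) s+b≡1+n)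
        where
        regroup : ∀ s b → s ℕ.+ (4 ℕ.+ b) ≡ 4 ℕ.+ (s ℕ.+ b)
        regroup = solve-∀
      in-range : ∀ j → j ℕ.≤ 4 → j ℕ.+ s ℕ.≤ N
      in-range j j≤4 = ℕP.≤-trans (ℕP.+-mono-≤ j≤4 (ℕP.m≤m+n s b))
                         (ℕP.≤-reflexive (≡.trans (sym (ℕP.+-assoc 4 s b)) (cong (4 ℕ.+_) s+b≡1+n)))

    mean-value-at-N-1 : Mean-value (4 ℕ.+ n)
    mean-value-at-N-1 = begin
      φ (r ℕ.+ (3 ℕ.+ n)) + φ (r ℕ.+ (4 ℕ.+ n)) + φ (r ℕ.+ 1) + φ (r ℕ.+ 2)
        ≡⟨ cong₂ _+_ (cong₂ _+_ (cong₂ _+_ (φ-back r 2 (s≤s (s≤s z≤n)) (s≤s (s≤s z≤n))) (φ-back r 1 (s≤s z≤n) (s≤s z≤n)))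
                                (≡.trans (φ-forward r 1) φ-N)) (≡.trans (φ-forward r 2) (φ-periodic 1)) ⟩
      φ (2 ℕ.+ n) + φ (3 ℕ.+ n) + formula N 0 + φ 1
        ≡⟨ cong₂ _+_ (cong₂ _+_ (cong₂ _+_ (φ-≤ (2 ℕ.+ n) (ℕP.m≤n+m _ 3)) (φ-≤ (3 ℕ.+ n) (ℕP.m≤n+m _ 2))) refl) (φ-≤ 1 (s≤s z≤n)) ⟩
      formula N (2 ℕ.+ n) + formula N (3 ℕ.+ n) + formula N 0 + formula N 1
        ≡⟨ formula-at-N-1 ⟩
      ι 4 * (formula N r - 1ℚ) ∎
      where
      open ≡-Reasoning
      r : ℕ
      r = 4 ℕ.+ n

    mean-value : ∀ r → 0 ℕ.< r → r ℕ.< N → Mean-value r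
    mean-value (suc zero)    _ _   = mean-value-at-1
    mean-value (suc (suc s)) _ r<N = by-position (ℕP.<-cmp s (2 ℕ.+ n))
      where
      by-position : Tri (s ℕ.< 2 ℕ.+ n) (s ≡ 2 ℕ.+ n) (2 ℕ.+ n ℕ.< s) → Mean-value (2 ℕ.+ s)
      by-position (tri< s<2+n _ _) = mean-value-interior s _ (proj₂ (ℕP.m≤n⇒∃[o]m+o≡n (ℕP.≤-pred s<2+n)))
      by-position (tri≈ _ refl _)  = mean-value-at-N-1
      by-position (tri> _ _ s>2+n) = ⊥-elim (ℕP.<-irrefl refl (ℕP.<-≤-trans s>2+n (ℕP.≤-pred (ℕP.≤-pred (ℕP.≤-pred r<N)))))

    φ-harmonic : ∀ w → w % N ≢ 0 →
      φ (w ℕ.+ (3 ℕ.+ n)) + φ (w ℕ.+ (4 ℕ.+ n)) + φ (w ℕ.+ 1) + φ (w ℕ.+ 2) ≡ ι 4 * (φ w - 1ℚ)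
    φ-harmonic w w≢0 = ≡.trans
      (cong₂ _+_ (cong₂ _+_ (cong₂ _+_ (φ-mod w (3 ℕ.+ n)) (φ-mod w (4 ℕ.+ n))) (φ-mod w 1)) (φ-mod w 2))
      (mean-value (w % N) (ℕP.n≢0⇒n>0 w≢0) (m%n<n w N))

    module Target (l : Fin N) where

      private
        L : ℕ
        L = toℕ l

        -- The formula at the cyclic offset y - l; since formula N k = formula N (N - k),
        -- the direction of the offset is irrelevant.
        shifted : ℕ → ℚ
        shifted y = φ (y ℕ.+ (N ℕ.∸ L))

        shifted-periodic : Periodic N shifted
        shifted-periodic y = ≡.trans (cong φ (swap y N (N ℕ.∸ L))) (φ-periodic (y ℕ.+ (N ℕ.∸ L)))
          where
          swap : ∀ a b c → a ℕ.+ b ℕ.+ c ≡ a ℕ.+ c ℕ.+ b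
          swap = solve-∀

        v≢l : ∀ v → eqFin v l ≡ false → toℕ v ≢ L
        v≢l v v≢ᵇl v≡l with () ← ≡.trans (sym v≢ᵇl) (dec-true (toℕ v ℕP.≟ L) v≡l)

      H : Fin N → ℚ
      H w = shifted (toℕ w)

      H-target : H l ≡ 0ℚ
      H-target = ≡.trans (cong φ (ℕP.m+[n∸m]≡n (ℕP.<⇒≤ (toℕ<n l)))) (≡.trans φ-N formula-zero)

      H-start : H Fin.zero ≡ formula N L
      H-start = ≡.trans (φ-≤ (N ℕ.∸ L) (ℕP.m∸n≤m N L)) (formula-sym L (ℕP.<⇒≤ (toℕ<n l)))

      H≤bound : ∀ v → H v ≤ ι bound
      H≤bound v = formula≤bound _ (m%n≤n (toℕ v ℕ.+ (N ℕ.∸ L)) N)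

      1≤H : ∀ v → eqFin v l ≡ false → 1ℚ ≤ H v
      1≤H v v≢ᵇl = 1≤formula _ (ℕP.n≢0⇒n>0 (residue-≢0 (toℕ<n l) (toℕ<n v) (v≢l v v≢ᵇl))) (m%n<n (toℕ v ℕ.+ (N ℕ.∸ L)) N)

      H-harmonic : ∀ v → eqFin v l ≡ false → sumFin (λ w → trans N v w * H w) ≡ H v - 1ℚ
      H-harmonic v v≢ᵇl = begin
        sumFin (λ w → trans N v w * H w)
          ≡⟨ trans-average v shifted shifted-periodic ⟩
        frac 1 4 * ((shifted (x ℕ.+ 1) + shifted (x ℕ.+ (4 ℕ.+ n))) + (shifted (x ℕ.+ 2) + shifted (x ℕ.+ (3 ℕ.+ n))))
          ≡⟨ cong (frac 1 4 *_) (cong₂ _+_ (cong₂ _+_ (around 1) (around (4 ℕ.+ n))) (cong₂ _+_ (around 2) (around (3 ℕ.+ n)))) ⟩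
        frac 1 4 * ((φ (w ℕ.+ 1) + φ (w ℕ.+ (4 ℕ.+ n))) + (φ (w ℕ.+ 2) + φ (w ℕ.+ (3 ℕ.+ n))))
          ≡⟨ cong (frac 1 4 *_) (solve 4 (λ a b c d → (a :+ b) :+ (c :+ d) := d :+ b :+ a :+ c) refl
                                    (φ (w ℕ.+ 1)) (φ (w ℕ.+ (4 ℕ.+ n))) (φ (w ℕ.+ 2)) (φ (w ℕ.+ (3 ℕ.+ n)))) ⟩
        frac 1 4 * (φ (w ℕ.+ (3 ℕ.+ n)) + φ (w ℕ.+ (4 ℕ.+ n)) + φ (w ℕ.+ 1) + φ (w ℕ.+ 2))
          ≡⟨ cong (frac 1 4 *_) (φ-harmonic w (residue-≢0 (toℕ<n l) (toℕ<n v) (v≢l v v≢ᵇl))) ⟩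
        frac 1 4 * (ι 4 * (φ w - 1ℚ))
          ≡⟨ *-assoc (frac 1 4) (ι 4) (φ w - 1ℚ) ⟨
        1ℚ * (φ w - 1ℚ)
          ≡⟨ *-identityˡ (φ w - 1ℚ) ⟩
        H v - 1ℚ ∎
        where
        open ≡-Reasoning
        open +-*-Solver
        x w : ℕ
        x = toℕ v
        w = x ℕ.+ (N ℕ.∸ L)
        around : ∀ k → shifted (x ℕ.+ k) ≡ φ (w ℕ.+ k)
        around k = cong φ (swap x k (N ℕ.∸ L))
          where
          swap : ∀ a b c → a ℕ.+ b ℕ.+ c ≡ a ℕ.+ c ℕ.+ b
          swap = solve-∀

  sumFin-start : ∀ {m} (f : Fin (suc m) → ℚ) → sumFin (λ w → (if toℕ w ≡ᵇ 0 then 1ℚ else 0ℚ) * f w) ≡ f Fin.zero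
  sumFin-start {m} f = begin
    1ℚ * f Fin.zero + sumFin (λ w → 0ℚ * f (Fin.suc w)) ≡⟨ cong₂ _+_ (*-identityˡ (f Fin.zero)) (sumFin-cong (λ w → *-zeroˡ (f (Fin.suc w)))) ⟩
    f Fin.zero + sumFin {m} (λ _ → 0ℚ)                   ≡⟨ cong (f Fin.zero +_) (sumFin-zero m) ⟩
    f Fin.zero + 0ℚ                                      ≡⟨ +-identityʳ (f Fin.zero) ⟩
    f Fin.zero                                           ∎
    where open ≡-Reasoning

  module RandomWalk (n : ℕ) (l : Fin (5 ℕ.+ n)) where
    open Cycle n using (N; trans-nonNeg; trans-stochastic)
    open Formula n using (bound)
    open Harmonic n using (module Target)
    open Target l

    private
      q₀-nonNeg : ∀ w → 0ℚ ≤ q N l 0 w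
      q₀-nonNeg w with toℕ w ≡ᵇ 0
      ... | true  = ≤ᵇ⇒≤ tt
      ... | false = ≤-refl

      q₀-total : sumFin (q N l 0) ≡ 1ℚ
      q₀-total = ≡.trans (sumFin-cong (λ w → sym (*-identityʳ (q N l 0 w)))) (sumFin-start {4 ℕ.+ n} (λ _ → 1ℚ))

    open KilledChain (trans N) l trans-nonNeg trans-stochastic (q N l) (λ _ _ → refl) q₀-nonNeg q₀-total
    -- bound = N² + 2N reduces to a successor, so ι (suc (ℕ.pred bound)) is ι bound by definition.
    open Potential H (ℕ.pred bound) H-target 1≤H H≤bound H-harmonic public

    potential₀ : potential 0 ≡ formula N (toℕ l)
    potential₀ = ≡.trans (sumFin-start {4 ℕ.+ n} H) H-start

open HittingTime using (module RandomWalk)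

open import Data.Nat.Base using (ℕ; _≤_)
open import Data.Fin.Base using (Fin; toℕ)
open import Data.Product using (Σ; _×_; _,_)
open import Data.Rational.Base using (ℚ; 0ℚ; 1ℚ; _<_; _-_; ∣_∣)
import Data.Nat.Properties as ℕP
open import Relation.Binary.PropositionalEquality using (refl)

theorem1p2 : (N : ℕ) → 5 ≤ N → (l : Fin N) → (ε : ℚ) → 0ℚ < ε →
    Σ ℕ (λ T₀ → (T : ℕ) → T₀ ≤ T →
    (∣ massUpTo N l T - 1ℚ ∣ < ε) × (∣ expUpTo N l T - formula N (toℕ l) ∣ < ε))
theorem1p2 N 5≤N l with n , refl ← ℕP.m≤n⇒∃[o]m+o≡n 5≤N =
  hitting-time-converges potential₀ (massUpTo N l) (expUpTo N l) refl (λ _ → refl) refl (λ _ → refl)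
  where open RandomWalk n l
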